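{- Fix $t\ge1$ and $n\ge1$. For any $t$-tuple $(\mu^1,\ldots,\mu^t)$ of partitions of $n$, the sum \[\sum_{\lambda\vdash n}(-1)^{n-\ell(\lambda)}\frac{\ell(\lambda)!}{\prod_i m_i(\lambda)!}\prod_{j=1}^tK_{\mu^j,\lambda}\] is a nonnegative integer.
   Context: For $\lambda\vdash n$, $\ell(\lambda)$ is the number of parts of $\lambda$ and $m_i(\lambda)$ is the number of parts equal to $i$. $K_{\mu,\lambda}$ is the Kostka number: the number of semistandard Young tableaux of shape $\mu$ and content $\lambda$. -}

module Defs where

open import Data.Nat using (ℕ; zero; suc; _≤_; _<_; _≤?_; _<?_; _≟_; _≡ᵇ_; _∸_; _!; NonZero)
import Data.Nat as ℕ
open import Data.Nat.Properties using (_!≢0; m*n≢0)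
open import Data.Integer as ℤ using (ℤ; +_)
open import Data.Rational as ℚ using (ℚ)
open import Data.List using (List; []; _∷_; map; concat; concatMap; length; filter; filterᵇ; foldr; upTo)
open import Data.Nat.ListAction using (sum)
open import Data.List.Properties using (≡-dec)
open import Data.List.Relation.Unary.All using (All; all?)
open import Data.List.Relation.Unary.Linked using (Linked; linked?)
open import Data.Fin using (Fin)
open import Data.Product using (_×_; _,_)
open import Data.Product.Properties using () 
open import Data.Unit using (⊤; tt)
open import Data.Empty using (⊥)
open import Relation.Nullary using (Dec; yes; no)
open import Relation.Nullary.Decidable using (_×-dec_)
open import Relation.Binary.PropositionalEquality using (_≡_)

IsPartition : ℕ → List ℕ → Set
IsPartition n λ′ = (sum λ′ ≡ n) × All (λ x → 1 ≤ x) λ′ × Linked (λ a b → b ≤ a) λ′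

isPartition? : ∀ n λ′ → Dec (IsPartition n λ′)
isPartition? n λ′ = (sum λ′ ≟ n) ×-dec (all? (λ x → 1 ≤? x) λ′ ×-dec linked? (λ a b → b ≤? a) λ′)

oneTo : ℕ → List ℕ
oneTo k = map suc (upTo k)

listsOfLength : ℕ → List ℕ → List (List ℕ)
listsOfLength zero    xs = [] ∷ []
listsOfLength (suc k) xs = concatMap (λ x → map (x ∷_) (listsOfLength k xs)) xs

candidates : ℕ → List (List ℕ)
candidates n = concatMap (λ k → listsOfLength k (oneTo n)) (upTo (suc n))

partitionsOf : ℕ → List (List ℕ)
partitionsOf n = filter (isPartition? n) (candidates n)

ℓ : List ℕ → ℕ
ℓ = length

count : ℕ → List ℕ → ℕ
count i xs = length (filterᵇ (λ x → x ≡ᵇ i) xs)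

mult : ℕ → List ℕ → ℕ
mult i λ′ = count i λ′

-- Semistandard Young tableaux, given as the list of their rows
-- (row r of a tableau of shape μ has length μ_r).

ColStrict : List ℕ → List ℕ → Set
ColStrict _        []        = ⊤
ColStrict []       (_ ∷ _)   = ⊥
ColStrict (a ∷ as) (b ∷ bs)  = (a < b) × ColStrict as bs

colStrict? : ∀ R R′ → Dec (ColStrict R R′)
colStrict? _        []       = yes tt
colStrict? []       (_ ∷ _)  = no (λ ())
colStrict? (a ∷ as) (b ∷ bs) = (a <? b) ×-dec colStrict? as bs

IsSSYT : List (List ℕ) → Set
IsSSYT T = All (Linked _≤_) T × Linked ColStrict T

isSSYT? : ∀ T → Dec (IsSSYT T)
isSSYT? T = all? (linked? _≤?_) T ×-dec linked? colStrict? T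

HasContent : List ℕ → List (List ℕ) → Set
HasContent λ′ T = All (All (λ x → (1 ≤ x) × (x ≤ ℓ λ′))) T
                × (map (λ i → count i (concat T)) (oneTo (ℓ λ′)) ≡ λ′)

hasContent? : ∀ λ′ T → Dec (HasContent λ′ T)
hasContent? λ′ T = all? (all? (λ x → (1 ≤? x) ×-dec (x ≤? ℓ λ′))) T
                 ×-dec ≡-dec _≟_ (map (λ i → count i (concat T)) (oneTo (ℓ λ′))) λ′

fillings : List ℕ → ℕ → List (List (List ℕ))
fillings []      k = [] ∷ []
fillings (m ∷ μ) k = concatMap (λ R → map (R ∷_) (fillings μ k)) (listsOfLength m (oneTo k))

kostka : List ℕ → List ℕ → ℕ
kostka μ λ′ = length (filter (λ T → isSSYT? T ×-dec hasContent? λ′ T) (fillings μ (ℓ λ′)))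

prodFact : List ℕ → ℕ
prodFact []       = 1
prodFact (x ∷ xs) = (x !) ℕ.* prodFact xs

prodFact≢0 : ∀ xs → NonZero (prodFact xs)
prodFact≢0 []       = _
prodFact≢0 (x ∷ xs) = m*n≢0 (x !) (prodFact xs) {{x !≢0}} {{prodFact≢0 xs}}

-- ∏_{i=1}^{n} m_i(λ)!   (other i contribute 0! = 1)
multFactProd : ℕ → List ℕ → ℕ
multFactProd n λ′ = prodFact (map (λ i → mult i λ′) (oneTo n))

kostkaProd : (t : ℕ) → (Fin t → List ℕ) → List ℕ → ℕ
kostkaProd t μ λ′ = foldr ℕ._*_ 1 (map (λ j → kostka (μ j) λ′) (Data.List.allFin t))
  where import Data.List

term : (n t : ℕ) → (Fin t → List ℕ) → List ℕ → ℚ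
term n t μ λ′ =
  ℚ._/_ (((ℤ.- ℤ.1ℤ) ℤ.^ (n ∸ ℓ λ′)) ℤ.* (+ (ℓ λ′ !)) ℤ.* (+ kostkaProd t μ λ′))
        (multFactProd n λ′) {{prodFact≢0 (map (λ i → mult i λ′) (oneTo n))}}

theSum : (n t : ℕ) → (Fin t → List ℕ) → ℚ
theSum n t μ = foldr ℚ._+_ ℚ.0ℚ (map (term n t μ) (partitionsOf n))

{-# OPTIONS --safe #-}
-- Kostka numbers are symmetric in the content (by a Bender–Knuth involution on the shapes between
-- two consecutive horizontal strips), and ℓ(λ)!/∏ m_i(λ)! counts the rearrangements of λ, so the sum
-- equals Σ_α (-1)^(n-ℓ(α)) ∏_j K_{μ^j,α} over all compositions α of n. Encode α by the set of gaps
-- 1 … n-1 at which it is cut. Peeling off the largest entries first, a tableau of shape μ and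
-- content α becomes a word of corner removals from μ down to the empty shape whose rows weakly
-- increase across every uncut gap. The signed sum over cut sets therefore factors, gap by gap, into
-- 1 - [all t words weakly ascend there]: it counts the t-tuples of removal words with no common weak
-- ascent.
module Submission where

module FiniteSums where

  open import Data.Nat using (ℕ; zero; suc; _+_; _*_)
  open import Data.Nat.Properties using (+-assoc; +-comm; +-identityʳ; *-distribˡ-+; *-zeroʳ; *-comm)
  open import Data.Nat.Tactic.RingSolver using (solve-∀)
  open import Data.Bool using (true; false)
  open import Data.List using (List; []; _∷_; map; length; filter; _++_; concat; concatMap; upTo; applyUpTo)
  open import Data.List.Properties using (map-∘; map-id-local; length-map)
  open import Data.List.Membership.Propositional using (_∈_; find; lose)
  open import Data.List.Membership.Propositional.Properties using (∈-map⁺; ∈-map⁻; ∈-filter⁺; ∈-filter⁻; ∈-concatMap⁺; ∈-concatMap⁻)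
  open import Data.List.Membership.Propositional.Properties.WithK using (unique∧set⇒bag)
  open import Data.List.Relation.Unary.Any using (here; there)
  open import Data.List.Relation.Unary.All using (lookup)
  import Data.List.Relation.Unary.All as All
  open import Data.List.Relation.Unary.Unique.Propositional using (Unique; []; _∷_)
  import Data.List.Relation.Unary.Unique.Propositional.Properties as Unique
  open import Data.List.Relation.Binary.BagAndSetEquality using (∼bag⇒↭)
  open import Data.List.Relation.Binary.Permutation.Propositional as ↭ using (_↭_; prep; swap)
  open import Data.List.Relation.Binary.Permutation.Propositional.Properties using (↭-length)
  open import Data.Product using (_×_; _,_; proj₁; proj₂)
  open import Data.Sum using (_⊎_; inj₁; inj₂)
  open import Data.Empty using (⊥-elim)
  open import Function.Bundles using (mk⇔)
  open import Relation.Nullary using (Dec; yes; no; ¬_; _because_)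
  open import Relation.Nullary.Decidable using (_×-dec_)
  open import Relation.Unary using (Decidable)
  open import Relation.Binary.PropositionalEquality using (_≡_; _≢_; refl; sym; trans; cong; cong₂; subst; _≗_; module ≡-Reasoning)

  ∑ : {A : Set} → List A → (A → ℕ) → ℕ
  ∑ []       f = 0
  ∑ (x ∷ xs) f = f x + ∑ xs f

  𝟙 : {P : Set} → Dec P → ℕ
  𝟙 (true  because _) = 1
  𝟙 (false because _) = 0

  module _ {P : Set} where

    𝟙-yes : (d : Dec P) → P → 𝟙 d ≡ 1
    𝟙-yes (yes _) _ = refl
    𝟙-yes (no ¬p) p = ⊥-elim (¬p p)

    𝟙-no : (d : Dec P) → ¬ P → 𝟙 d ≡ 0
    𝟙-no (yes p) ¬p = ⊥-elim (¬p p)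
    𝟙-no (no _)  _  = refl

    𝟙≡0⊎𝟙≡1 : (d : Dec P) → 𝟙 d ≡ 0 ⊎ 𝟙 d ≡ 1
    𝟙≡0⊎𝟙≡1 (yes _) = inj₂ refl
    𝟙≡0⊎𝟙≡1 (no _)  = inj₁ refl

    𝟙-*-cong : (d : Dec P) {x y : ℕ} → (P → x ≡ y) → 𝟙 d * x ≡ 𝟙 d * y
    𝟙-*-cong (yes p) eq = cong (1 *_) (eq p)
    𝟙-*-cong (no _)  _  = refl

  𝟙-⇔ : {P Q : Set} (d : Dec P) (e : Dec Q) → (P → Q) → (Q → P) → 𝟙 d ≡ 𝟙 e
  𝟙-⇔ (yes p) e f g = sym (𝟙-yes e (f p))
  𝟙-⇔ (no ¬p) e f g = sym (𝟙-no e (λ q → ¬p (g q)))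

  𝟙-× : {P Q : Set} (d : Dec P) (e : Dec Q) → 𝟙 (d ×-dec e) ≡ 𝟙 d * 𝟙 e
  𝟙-× (yes _) (yes _) = refl
  𝟙-× (yes _) (no _)  = refl
  𝟙-× (no _)  _       = refl

  module _ {A : Set} where

    ∑-cong-local : (xs : List A) {f g : A → ℕ} → (∀ {x} → x ∈ xs → f x ≡ g x) → ∑ xs f ≡ ∑ xs g
    ∑-cong-local []       eq = refl
    ∑-cong-local (x ∷ xs) eq = cong₂ _+_ (eq (here refl)) (∑-cong-local xs (λ x∈xs → eq (there x∈xs)))

    ∑-cong : (xs : List A) {f g : A → ℕ} → f ≗ g → ∑ xs f ≡ ∑ xs g
    ∑-cong xs eq = ∑-cong-local xs (λ {x} _ → eq x)

    ∑-++ : (xs ys : List A) (f : A → ℕ) → ∑ (xs ++ ys) f ≡ ∑ xs f + ∑ ys f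
    ∑-++ []       ys f = refl
    ∑-++ (x ∷ xs) ys f = trans (cong (f x +_) (∑-++ xs ys f)) (sym (+-assoc (f x) _ _))

    ∑-concat : (xss : List (List A)) (f : A → ℕ) → ∑ (concat xss) f ≡ ∑ xss (λ xs → ∑ xs f)
    ∑-concat []         f = refl
    ∑-concat (xs ∷ xss) f = trans (∑-++ xs (concat xss) f) (cong (∑ xs f +_) (∑-concat xss f))

    ∑-+ : (xs : List A) (f g : A → ℕ) → ∑ xs (λ x → f x + g x) ≡ ∑ xs f + ∑ xs g
    ∑-+ []       f g = refl
    ∑-+ (x ∷ xs) f g = trans (cong (f x + g x +_) (∑-+ xs f g)) (interchange (f x) (g x) (∑ xs f) (∑ xs g))
      where
      interchange : ∀ a b c d → (a + b) + (c + d) ≡ (a + c) + (b + d)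
      interchange = solve-∀

    ∑-*ˡ : (xs : List A) (c : ℕ) (f : A → ℕ) → ∑ xs (λ x → c * f x) ≡ c * ∑ xs f
    ∑-*ˡ []       c f = sym (*-zeroʳ c)
    ∑-*ˡ (x ∷ xs) c f = trans (cong (c * f x +_) (∑-*ˡ xs c f)) (sym (*-distribˡ-+ c (f x) _))

    ∑-*ʳ : (xs : List A) (f : A → ℕ) (c : ℕ) → ∑ xs (λ x → f x * c) ≡ ∑ xs f * c
    ∑-*ʳ xs f c = trans (∑-cong xs (λ x → *-comm (f x) c)) (trans (∑-*ˡ xs c f) (*-comm c (∑ xs f)))

    ∑-0 : (xs : List A) (f : A → ℕ) → (∀ {x} → x ∈ xs → f x ≡ 0) → ∑ xs f ≡ 0
    ∑-0 []       f eq = refl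
    ∑-0 (x ∷ xs) f eq rewrite eq (here refl) = ∑-0 xs f (λ x∈xs → eq (there x∈xs))

    ∑-↭ : {xs ys : List A} (f : A → ℕ) → xs ↭ ys → ∑ xs f ≡ ∑ ys f
    ∑-↭ f ↭.refl = refl
    ∑-↭ f (prep x p) = cong (f x +_) (∑-↭ f p)
    ∑-↭ f (swap x y p) = trans (sym (+-assoc (f x) (f y) _))
      (trans (cong₂ _+_ (+-comm (f x) (f y)) (∑-↭ f p)) (+-assoc (f y) (f x) _))
    ∑-↭ f (↭.trans p q) = trans (∑-↭ f p) (∑-↭ f q)

    length≡∑1 : (xs : List A) → length xs ≡ ∑ xs (λ _ → 1)
    length≡∑1 []       = refl
    length≡∑1 (x ∷ xs) = cong suc (length≡∑1 xs)

    length-filter≡∑𝟙 : {P : A → Set} (P? : Decidable P) (xs : List A) → length (filter P? xs) ≡ ∑ xs (λ x → 𝟙 (P? x))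
    length-filter≡∑𝟙 P? []       = refl
    length-filter≡∑𝟙 P? (x ∷ xs) with P? x
    ... | yes _ = cong suc (length-filter≡∑𝟙 P? xs)
    ... | no  _ = length-filter≡∑𝟙 P? xs

    length-filter-∷ : {P : A → Set} (P? : Decidable P) (x : A) (xs : List A) →
                      length (filter P? (x ∷ xs)) ≡ 𝟙 (P? x) + length (filter P? xs)
    length-filter-∷ P? x xs with P? x
    ... | yes _ = refl
    ... | no  _ = refl

    ∑-filter-0 : {P : A → Set} (P? : Decidable P) (xs : List A) (f : A → ℕ) →
                 (∀ {x} → ¬ P x → f x ≡ 0) → ∑ (filter P? xs) f ≡ ∑ xs f
    ∑-filter-0 P? []       f vanish = refl
    ∑-filter-0 P? (x ∷ xs) f vanish with P? x
    ... | yes _  = cong (f x +_) (∑-filter-0 P? xs f vanish)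
    ... | no ¬px = trans (∑-filter-0 P? xs f vanish) (cong (_+ ∑ xs f) (sym (vanish ¬px)))

    ∑-single : (xs : List A) → Unique xs → {x₀ : A} → x₀ ∈ xs → (f : A → ℕ) →
               (∀ {x} → x ∈ xs → x ≢ x₀ → f x ≡ 0) → ∑ xs f ≡ f x₀
    ∑-single (x ∷ xs) (x≢xs ∷ _) (here refl) f vanish =
      trans (cong (f x +_) (∑-0 xs f (λ y∈xs → vanish (there y∈xs) (λ y≡x → lookup x≢xs y∈xs (sym y≡x)))))
            (+-identityʳ (f x))
    ∑-single (x ∷ xs) (x≢xs ∷ uxs) (there x₀∈xs) f vanish =
      trans (cong (_+ ∑ xs f) (vanish (here refl) (lookup x≢xs x₀∈xs)))
            (∑-single xs uxs x₀∈xs f (λ y∈xs → vanish (there y∈xs)))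

  module _ {A B : Set} where

    ∑-map : (g : A → B) (xs : List A) (f : B → ℕ) → ∑ (map g xs) f ≡ ∑ xs (λ x → f (g x))
    ∑-map g []       f = refl
    ∑-map g (x ∷ xs) f = cong (f (g x) +_) (∑-map g xs f)

    ∑-concatMap : (g : A → List B) (xs : List A) (f : B → ℕ) → ∑ (concatMap g xs) f ≡ ∑ xs (λ x → ∑ (g x) f)
    ∑-concatMap g []       f = refl
    ∑-concatMap g (x ∷ xs) f = trans (∑-++ (g x) (concatMap g xs) f) (cong (∑ (g x) f +_) (∑-concatMap g xs f))

    length-concatMap : (f : A → List B) (xs : List A) → length (concatMap f xs) ≡ ∑ xs (λ x → length (f x))
    length-concatMap f xs = trans (length≡∑1 (concatMap f xs))
      (trans (∑-concatMap f xs (λ _ → 1)) (∑-cong xs (λ x → sym (length≡∑1 (f x)))))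

    ∑-comm : (xs : List A) (ys : List B) (f : A → B → ℕ) →
             ∑ xs (λ x → ∑ ys (λ y → f x y)) ≡ ∑ ys (λ y → ∑ xs (λ x → f x y))
    ∑-comm []       ys f = sym (∑-0 ys (λ _ → 0) (λ _ → refl))
    ∑-comm (x ∷ xs) ys f = trans (cong (∑ ys (f x) +_) (∑-comm xs ys f)) (sym (∑-+ ys (f x) (λ y → ∑ xs (λ x′ → f x′ y))))

    unique-concatMap⁺ : (g : A → List B) {xs : List A} → Unique xs → (∀ x → Unique (g x)) →
                        (∀ {x x′ y} → x ∈ xs → x′ ∈ xs → y ∈ g x → y ∈ g x′ → x ≡ x′) →
                        Unique (concatMap g xs)
    unique-concatMap⁺ g {[]}     _            _  _        = []
    unique-concatMap⁺ g {x ∷ xs} (x≢xs ∷ uxs) ug disjoint =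
      Unique.++⁺ (ug x) (unique-concatMap⁺ g uxs ug (λ m m′ → disjoint (there m) (there m′))) apart
      where
      apart : ∀ {y} → ¬ (y ∈ g x × y ∈ concatMap g xs)
      apart (y∈gx , y∈rest) with find (∈-concatMap⁻ g {xs = xs} y∈rest)
      ... | x′ , x′∈xs , y∈gx′ = lookup x≢xs x′∈xs (disjoint (here refl) (there x′∈xs) y∈gx y∈gx′)

    ∑𝟙-bijection : {xs : List A} {ys : List B} → Unique xs → Unique ys →
                   {P : A → Set} (P? : Decidable P) {Q : B → Set} (Q? : Decidable Q) (f : A → B) (g : B → A) →
                   (∀ {x} → x ∈ xs → P x → (f x ∈ ys) × Q (f x) × (g (f x) ≡ x)) →
                   (∀ {y} → y ∈ ys → Q y → (g y ∈ xs) × P (g y) × (f (g y) ≡ y)) →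
                   ∑ xs (λ x → 𝟙 (P? x)) ≡ ∑ ys (λ y → 𝟙 (Q? y))
    ∑𝟙-bijection {xs} {ys} uxs uys P? Q? f g to from = begin
      ∑ xs (λ x → 𝟙 (P? x))  ≡⟨ length-filter≡∑𝟙 P? xs ⟨
      length xsP             ≡⟨ length-map f xsP ⟨
      length (map f xsP)     ≡⟨ ↭-length image↭ysQ ⟩
      length (filter Q? ys)  ≡⟨ length-filter≡∑𝟙 Q? ys ⟩
      ∑ ys (λ y → 𝟙 (Q? y))  ∎
      where
      open ≡-Reasoning
      xsP = filter P? xs
      g∘f≡id : map g (map f xsP) ≡ xsP
      g∘f≡id = trans (sym (map-∘ xsP)) (map-id-local (All.tabulate (λ x∈xsP →
        let x∈xs , px = ∈-filter⁻ P? x∈xsP in proj₂ (proj₂ (to x∈xs px)))))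
      image-unique : Unique (map f xsP)
      image-unique = Unique.map⁻ (subst Unique (sym g∘f≡id) (Unique.filter⁺ P? uxs))
      into : ∀ {y} → y ∈ map f xsP → y ∈ filter Q? ys
      into y∈image with ∈-map⁻ f y∈image
      ... | x , x∈xsP , refl = let x∈xs , px = ∈-filter⁻ P? x∈xsP ; fx∈ys , qfx , _ = to x∈xs px
                               in ∈-filter⁺ Q? fx∈ys qfx
      onto : ∀ {y} → y ∈ filter Q? ys → y ∈ map f xsP
      onto y∈ysQ with ∈-filter⁻ Q? y∈ysQ
      ... | y∈ys , qy = let gy∈xs , pgy , fgy≡y = from y∈ys qy
                        in subst (_∈ map f xsP) fgy≡y (∈-map⁺ f (∈-filter⁺ P? gy∈xs pgy))
      image↭ysQ : map f xsP ↭ filter Q? ys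
      image↭ysQ = ∼bag⇒↭ (unique∧set⇒bag image-unique (Unique.filter⁺ Q? uys) (mk⇔ into onto))

  module _ {A B : Set} where

    pairs : List A → (A → List B) → List (A × B)
    pairs xs ys = concatMap (λ x → map (x ,_) (ys x)) xs

    ∈-pairs⁻ : ∀ {xs ys x y} → (x , y) ∈ pairs xs ys → (x ∈ xs) × (y ∈ ys x)
    ∈-pairs⁻ {xs} {ys} p∈ with find (∈-concatMap⁻ (λ x → map (x ,_) (ys x)) {xs = xs} p∈)
    ... | x , x∈xs , p∈′ with ∈-map⁻ (x ,_) p∈′
    ... | y , y∈ys , refl = x∈xs , y∈ys

    ∈-pairs⁺ : ∀ {xs ys x y} → x ∈ xs → y ∈ ys x → (x , y) ∈ pairs xs ys
    ∈-pairs⁺ {xs} {ys} {x} x∈xs y∈ys = ∈-concatMap⁺ (λ x → map (x ,_) (ys x)) {xs = xs} (lose x∈xs (∈-map⁺ (x ,_) y∈ys))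

    pairs-unique : ∀ {xs ys} → Unique xs → (∀ x → Unique (ys x)) → Unique (pairs xs ys)
    pairs-unique {xs} {ys} uxs uys =
      unique-concatMap⁺ (λ x → map (x ,_) (ys x)) uxs (λ x → Unique.map⁺ (cong proj₂) (uys x)) (λ _ _ → same-first)
      where
      same-first : ∀ {x x′ p} → p ∈ map (x ,_) (ys x) → p ∈ map (x′ ,_) (ys x′) → x ≡ x′
      same-first p∈ p∈′ with ∈-map⁻ _ p∈ | ∈-map⁻ _ p∈′
      ... | _ , _ , refl | _ , _ , eq = cong proj₁ eq

    ∑-pairs : (xs : List A) (ys : A → List B) (f : A × B → ℕ) → ∑ (pairs xs ys) f ≡ ∑ xs (λ x → ∑ (ys x) (λ y → f (x , y)))
    ∑-pairs xs ys f = trans (∑-concatMap (λ x → map (x ,_) (ys x)) xs f) (∑-cong xs (λ x → ∑-map (x ,_) (ys x) f))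

  ∑-applyUpTo : ∀ {A : Set} (g : ℕ → A) W (f : A → ℕ) → ∑ (applyUpTo g W) f ≡ ∑ (upTo W) (λ i → f (g i))
  ∑-applyUpTo g zero    f = refl
  ∑-applyUpTo g (suc W) f = cong (f (g 0) +_)
    (trans (∑-applyUpTo (λ i → g (suc i)) W f) (sym (∑-applyUpTo suc W (λ i → f (g i)))))

  ∑-upTo-suc : ∀ W (f : ℕ → ℕ) → ∑ (upTo (suc W)) f ≡ f 0 + ∑ (upTo W) (λ i → f (suc i))
  ∑-upTo-suc W f = cong (f 0 +_) (∑-applyUpTo suc W f)

module Enumerations where

  open import Data.Nat using (ℕ; zero; suc; _≤_; z≤n; s≤s)
  open import Data.Nat.Properties using (+-mono-≤; m≤m+n; m≤n+m; ≤-trans; ≤-pred; suc-injective)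
  open import Data.Nat.ListAction using (sum)
  open import Data.List using (List; []; _∷_; map; length; upTo; _++_)
  open import Data.List.Properties using (map-++; upTo-∷ʳ; ∷-injective)
  open import Data.List.Membership.Propositional using (_∈_; find; lose)
  open import Data.List.Membership.Propositional.Properties using (∈-map⁺; ∈-map⁻; ∈-concatMap⁺; ∈-concatMap⁻; ∈-upTo⁺; ∈-upTo⁻; ∈-filter⁺; ∈-filter⁻)
  open import Data.List.Relation.Unary.Any using (here)
  open import Data.List.Relation.Unary.All using (All; []; _∷_)
  import Data.List.Relation.Unary.All as All
  open import Data.List.Relation.Unary.Unique.Propositional using (Unique; []; _∷_)
  import Data.List.Relation.Unary.Unique.Propositional.Properties as Unique
  open import Data.List.Relation.Binary.Pointwise using (Pointwise; []; _∷_)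
  open import Data.Product using (_×_; _,_; proj₁; proj₂)
  open import Relation.Binary.PropositionalEquality using (_≡_; refl; sym; trans; cong)
  open import Defs
  open FiniteSums

  ∈-listsOfLength⁻ : ∀ k (xs : List ℕ) {w} → w ∈ listsOfLength k xs → (length w ≡ k) × All (_∈ xs) w
  ∈-listsOfLength⁻ zero    xs (here refl) = refl , []
  ∈-listsOfLength⁻ (suc k) xs w∈ with find (∈-concatMap⁻ (λ x → map (x ∷_) (listsOfLength k xs)) {xs = xs} w∈)
  ... | x , x∈xs , w∈′ with ∈-map⁻ (x ∷_) w∈′
  ... | w′ , w′∈ , refl with ∈-listsOfLength⁻ k xs w′∈
  ... | len , all = cong suc len , (x∈xs ∷ all)

  ∈-listsOfLength⁺ : ∀ k (xs : List ℕ) {w} → length w ≡ k → All (_∈ xs) w → w ∈ listsOfLength k xs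
  ∈-listsOfLength⁺ zero    xs {[]}    refl []            = here refl
  ∈-listsOfLength⁺ (suc k) xs {x ∷ w} len  (x∈xs ∷ all) =
    ∈-concatMap⁺ (λ y → map (y ∷_) (listsOfLength k xs)) {xs = xs}
      (lose x∈xs (∈-map⁺ (x ∷_) (∈-listsOfLength⁺ k xs (suc-injective len) all)))

  listsOfLength-unique : ∀ k {xs : List ℕ} → Unique xs → Unique (listsOfLength k xs)
  listsOfLength-unique zero    uxs = [] ∷ []
  listsOfLength-unique (suc k) uxs =
    unique-concatMap⁺ (λ x → map (x ∷_) (listsOfLength k _)) uxs
      (λ x → Unique.map⁺ (λ eq → proj₂ (∷-injective eq)) (listsOfLength-unique k uxs))
      (λ _ _ → same-head)
    where
    same-head : ∀ {x x′ w} → w ∈ map (x ∷_) (listsOfLength k _) → w ∈ map (x′ ∷_) (listsOfLength k _) → x ≡ x′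
    same-head w∈ w∈′ with ∈-map⁻ _ w∈ | ∈-map⁻ _ w∈′
    ... | _ , _ , refl | _ , _ , eq = proj₁ (∷-injective eq)

  oneTo-∈⁻ : ∀ {k x} → x ∈ oneTo k → (1 ≤ x) × (x ≤ k)
  oneTo-∈⁻ x∈ with ∈-map⁻ suc x∈
  ... | y , y∈ , refl = s≤s z≤n , ∈-upTo⁻ y∈

  oneTo-∈⁺ : ∀ {k x} → 1 ≤ x → x ≤ k → x ∈ oneTo k
  oneTo-∈⁺ {x = suc x} _ x<k = ∈-map⁺ suc (∈-upTo⁺ x<k)

  oneTo-∷ʳ : ∀ k → oneTo (suc k) ≡ oneTo k ++ suc k ∷ []
  oneTo-∷ʳ k = trans (cong (map suc) (sym (upTo-∷ʳ k))) (map-++ suc (upTo k) (k ∷ []))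

  oneTo-unique : ∀ k → Unique (oneTo k)
  oneTo-unique k = Unique.map⁺ suc-injective (Unique.upTo⁺ k)

  InRange : ℕ → List ℕ → Set
  InRange k = All (λ x → (1 ≤ x) × (x ≤ k))

  RowOf : ℕ → ℕ → List ℕ → Set
  RowOf k m R = (length R ≡ m) × All (_∈ oneTo k) R

  IsFilling : List ℕ → ℕ → List (List ℕ) → Set
  IsFilling μ k T = Pointwise (RowOf k) μ T

  ∈-fillings⁻ : ∀ μ k {T} → T ∈ fillings μ k → IsFilling μ k T
  ∈-fillings⁻ []      k (here refl) = []
  ∈-fillings⁻ (m ∷ μ) k T∈ with find (∈-concatMap⁻ (λ R → map (R ∷_) (fillings μ k)) {xs = listsOfLength m (oneTo k)} T∈)
  ... | R , R∈ , T∈′ with ∈-map⁻ (R ∷_) T∈′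
  ... | T′ , T′∈ , refl = ∈-listsOfLength⁻ m (oneTo k) R∈ ∷ ∈-fillings⁻ μ k T′∈

  ∈-fillings⁺ : ∀ μ k {T} → IsFilling μ k T → T ∈ fillings μ k
  ∈-fillings⁺ []      k []                       = here refl
  ∈-fillings⁺ (m ∷ μ) k {R ∷ T} ((len , R⊆) ∷ fill) =
    ∈-concatMap⁺ (λ R → map (R ∷_) (fillings μ k)) {xs = listsOfLength m (oneTo k)}
      (lose (∈-listsOfLength⁺ m (oneTo k) len R⊆) (∈-map⁺ (R ∷_) (∈-fillings⁺ μ k fill)))

  fillings-unique : ∀ μ k → Unique (fillings μ k)
  fillings-unique []      k = [] ∷ []
  fillings-unique (m ∷ μ) k =
    unique-concatMap⁺ (λ R → map (R ∷_) (fillings μ k)) (listsOfLength-unique m (oneTo-unique k))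
      (λ R → Unique.map⁺ (λ eq → proj₂ (∷-injective eq)) (fillings-unique μ k))
      (λ _ _ → same-head)
    where
    same-head : ∀ {R R′ T} → T ∈ map (R ∷_) (fillings μ k) → T ∈ map (R′ ∷_) (fillings μ k) → R ≡ R′
    same-head T∈ T∈′ with ∈-map⁻ _ T∈ | ∈-map⁻ _ T∈′
    ... | _ , _ , refl | _ , _ , eq = proj₁ (∷-injective eq)

  filling-entries : ∀ {μ k T} → IsFilling μ k T → All (InRange k) T
  filling-entries []                = []
  filling-entries ((_ , R⊆) ∷ fill) = All.map oneTo-∈⁻ R⊆ ∷ filling-entries fill


  boundedLists : ℕ → ℕ → List (List ℕ)
  boundedLists N L = listsOfLength L (upTo (suc N))

  boundedLists-unique : ∀ N L → Unique (boundedLists N L)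
  boundedLists-unique N L = listsOfLength-unique L (Unique.upTo⁺ (suc N))

  ∈-boundedLists⁻ : ∀ {N L ν} → ν ∈ boundedLists N L → All (_≤ N) ν × (length ν ≡ L)
  ∈-boundedLists⁻ {N} {L} ν∈ with ∈-listsOfLength⁻ L (upTo (suc N)) ν∈
  ... | len , ν⊆ = All.map (λ x∈ → ≤-pred (∈-upTo⁻ x∈)) ν⊆ , len

  ∈-boundedLists⁺ : ∀ {N L ν} → All (_≤ N) ν → length ν ≡ L → ν ∈ boundedLists N L
  ∈-boundedLists⁺ {N} {L} ν≤N len = ∈-listsOfLength⁺ L (upTo (suc N)) len (All.map (λ x≤N → ∈-upTo⁺ (s≤s x≤N)) ν≤N)

  length≤sum : ∀ {λ′} → All (1 ≤_) λ′ → length λ′ ≤ sum λ′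
  length≤sum []          = z≤n
  length≤sum (1≤x ∷ pos) = +-mono-≤ 1≤x (length≤sum pos)

  part≤sum : ∀ λ′ → All (_≤ sum λ′) λ′
  part≤sum []       = []
  part≤sum (x ∷ λ′) = m≤m+n x (sum λ′) ∷ All.map (λ le → ≤-trans le (m≤n+m (sum λ′) x)) (part≤sum λ′)

  candidates-unique : ∀ n → Unique (candidates n)
  candidates-unique n =
    unique-concatMap⁺ (λ k → listsOfLength k (oneTo n)) (Unique.upTo⁺ (suc n))
      (λ k → listsOfLength-unique k (oneTo-unique n))
      (λ {k} {k′} _ _ w∈ w∈′ → trans (sym (proj₁ (∈-listsOfLength⁻ k (oneTo n) w∈))) (proj₁ (∈-listsOfLength⁻ k′ (oneTo n) w∈′)))

  partitionsOf-unique : ∀ n → Unique (partitionsOf n)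
  partitionsOf-unique n = Unique.filter⁺ (isPartition? n) (candidates-unique n)

  ∈-partitionsOf⁺ : ∀ {n λ′} → IsPartition n λ′ → λ′ ∈ partitionsOf n
  ∈-partitionsOf⁺ {n} {λ′} isP@(refl , pos , _) =
    ∈-filter⁺ (isPartition? n)
      (∈-concatMap⁺ (λ k → listsOfLength k (oneTo n)) {xs = upTo (suc n)}
        (lose (∈-upTo⁺ (s≤s (length≤sum pos)))
              (∈-listsOfLength⁺ _ (oneTo n) refl (All.zipWith (λ (1≤x , x≤n) → oneTo-∈⁺ 1≤x x≤n) (pos , part≤sum λ′)))))
      isP

  ∈-partitionsOf⁻ : ∀ {n λ′} → λ′ ∈ partitionsOf n → IsPartition n λ′
  ∈-partitionsOf⁻ {n} λ′∈ = proj₂ (∈-filter⁻ (isPartition? n) {xs = candidates n} λ′∈)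

module Tableaux where

  open import Data.Nat using (ℕ; zero; suc; _+_; _∸_; _≤_; _≤?_; _≟_; _≡ᵇ_; z≤n; s≤s; _<_)
  open import Data.Nat.Properties using (≤-refl; ≤-trans; <-≤-trans; ≤-antisym; ≤-pred; <⇒≤; <⇒≱; ≰⇒>; ≡ᵇ⇒≡; ≡⇒≡ᵇ; +-suc; m≤n⇒m≤1+n; m+[n∸m]≡n; <-irrefl; +-identityʳ)
  open import Data.Bool using (T?)
  open import Data.List using (List; []; _∷_; map; length; filter; replicate; _++_)
  open import Data.List.Properties using (filter-++; filter-all; filter-none; filter-accept; filter-reject; length-filter; length-++; length-replicate; ++-identityʳ)
  open import Data.List.Relation.Unary.All using (All; []; _∷_)
  import Data.List.Relation.Unary.All as All
  import Data.List.Relation.Unary.All.Properties as All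
  open import Data.List.Relation.Unary.Linked using (Linked; []; [-]; _∷_)
  import Data.List.Relation.Unary.Linked as Linked
  open import Data.List.Relation.Unary.Linked.Properties using (Linked⇒All)
  import Data.List.Relation.Unary.Linked.Properties as Linked
  open import Data.List.Membership.Propositional using (_∈_)
  open import Data.Product using (_,_)
  open import Data.Empty using (⊥-elim)
  open import Data.Unit using (tt)
  open import Relation.Nullary using (yes; no; ¬_)
  open import Relation.Binary.PropositionalEquality using (_≡_; refl; sym; trans; cong; cong₂; subst; module ≡-Reasoning; _≢_)
  open import Defs
  open FiniteSums
  open Enumerations

  -- count, restated as a sum of indicators so that the lemmas on ∑ apply to it
  occ : ℕ → List ℕ → ℕ
  occ i xs = ∑ xs (λ x → 𝟙 (x ≟ i))

  count≡occ : ∀ i xs → count i xs ≡ occ i xs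
  count≡occ i []       = refl
  count≡occ i (x ∷ xs) = trans (length-filter-∷ (λ y → T? (y ≡ᵇ i)) x xs)
    (cong₂ _+_ (𝟙-⇔ (T? (x ≡ᵇ i)) (x ≟ i) (≡ᵇ⇒≡ x i) (≡⇒≡ᵇ x i)) (count≡occ i xs))

  occ-none : ∀ {i R} → All (_≢ i) R → occ i R ≡ 0
  occ-none {i} {R} R≢i = ∑-0 R _ (λ x∈R → 𝟙-no (_ ≟ i) (All.lookup R≢i x∈R))

  occ-replicate : ∀ c x → occ x (replicate c x) ≡ c
  occ-replicate zero    x = refl
  occ-replicate (suc c) x = cong₂ _+_ (𝟙-yes (x ≟ x) refl) (occ-replicate c x)

  Sorted : List ℕ → Set
  Sorted = Linked _≤_

  sorted⇒head≤ : ∀ {x xs} → Sorted (x ∷ xs) → All (x ≤_) xs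
  sorted⇒head≤ s = All.tail (Linked⇒All ≤-trans ≤-refl s)

  module Rows (k : ℕ) where

    K : ℕ
    K = suc k

    deleteK : List ℕ → List ℕ
    deleteK = filter (_≤? k)

    padK : ℕ → List ℕ → List ℕ
    padK m R = R ++ replicate (m ∸ length R) K

    deleteK-∷-≤ : ∀ {R x} → x ≤ k → deleteK (x ∷ R) ≡ x ∷ deleteK R
    deleteK-∷-≤ = filter-accept (_≤? k)

    deleteK-∷-≰ : ∀ {R x} → ¬ x ≤ k → deleteK (x ∷ R) ≡ deleteK R
    deleteK-∷-≰ = filter-reject (_≤? k)

    deleteK-none : ∀ {R} → All (k <_) R → deleteK R ≡ []
    deleteK-none R>k = filter-none (_≤? k) (All.map <⇒≱ R>k)

    sorted-deleteK : ∀ {R} → Sorted R → Sorted (deleteK R)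
    sorted-deleteK = Linked.filter⁺ (_≤? k) ≤-trans

    length-deleteK≤ : ∀ R → length (deleteK R) ≤ length R
    length-deleteK≤ = length-filter (_≤? k)

    column-length : ∀ {R R′} → ColStrict R R′ → All (_≤ K) R′ → length R′ ≤ length (deleteK R)
    column-length {R}     {[]}     _          _            = z≤n
    column-length {x ∷ R} {y ∷ R′} (x<y , c) (y≤K ∷ R′≤K)
      rewrite deleteK-∷-≤ {R} (≤-pred (≤-trans x<y y≤K)) = s≤s (column-length c R′≤K)

    length-split : ∀ {R} → All (_≤ K) R → length R ≡ length (deleteK R) + occ K R
    length-split {[]}    []           = refl
    length-split {x ∷ R} (x≤K ∷ R≤K) with x ≤? k
    ... | yes x≤k rewrite deleteK-∷-≤ {R} x≤k | 𝟙-no (x ≟ K) (λ { refl → <-irrefl refl (s≤s x≤k) }) = cong suc (length-split R≤K)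
    ... | no  x≰k rewrite deleteK-∷-≰ {R} x≰k | 𝟙-yes (x ≟ K) (≤-antisym x≤K (≰⇒> x≰k)) =
      trans (cong suc (length-split R≤K)) (sym (+-suc _ _))

    deleteK-column : ∀ {R R′} → Sorted R′ → ColStrict R R′ → ColStrict (deleteK R) (deleteK R′)
    deleteK-column {R}     {[]}     _ _ = tt
    deleteK-column {x ∷ R} {y ∷ R′} s (x<y , c) with y ≤? k
    ... | no y≰k rewrite deleteK-∷-≰ {R′} y≰k | deleteK-none (All.map (<-≤-trans (≰⇒> y≰k)) (sorted⇒head≤ s)) = tt
    ... | yes y≤k with x ≤? k
    ...   | yes x≤k rewrite deleteK-∷-≤ {R} x≤k | deleteK-∷-≤ {R′} y≤k = x<y , deleteK-column (Linked.tail s) c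
    ...   | no x≰k = ⊥-elim (x≰k (≤-trans (<⇒≤ x<y) y≤k))

    occ-deleteK : ∀ {i} R → i ≤ k → occ i (deleteK R) ≡ occ i R
    occ-deleteK     []      i≤k = refl
    occ-deleteK {i} (x ∷ R) i≤k with x ≤? k
    ... | yes x≤k rewrite deleteK-∷-≤ {R} x≤k = cong (𝟙 (x ≟ i) +_) (occ-deleteK R i≤k)
    ... | no x≰k rewrite deleteK-∷-≰ {R} x≰k | 𝟙-no (x ≟ i) (λ { refl → x≰k i≤k }) = occ-deleteK R i≤k

    padK-deleteK : ∀ {R} → Sorted R → All (_≤ K) R → padK (length R) (deleteK R) ≡ R
    padK-deleteK {[]}    _ _ = refl
    padK-deleteK {x ∷ R} s (x≤K ∷ R≤K) with x ≤? k
    ... | yes x≤k rewrite deleteK-∷-≤ {R} x≤k = cong (x ∷_) (padK-deleteK (Linked.tail s) R≤K)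
    ... | no  x≰k rewrite deleteK-∷-≰ {R} x≰k | deleteK-none (All.map (<-≤-trans (≰⇒> x≰k)) (sorted⇒head≤ s)) = cong₂ _∷_ (sym x≡K) (all-K R (sorted⇒head≤ s) R≤K)
      where
      x≡K : x ≡ K
      x≡K = ≤-antisym x≤K (≰⇒> x≰k)
      all-K : ∀ R → All (x ≤_) R → All (_≤ K) R → replicate (length R) K ≡ R
      all-K []      []           []           = refl
      all-K (y ∷ R) (x≤y ∷ x≤R) (y≤K ∷ R≤K) =
        cong₂ _∷_ (≤-antisym (subst (_≤ y) x≡K x≤y) y≤K) (all-K R x≤R R≤K)

    deleteK-padK : ∀ {R} m → All (_≤ k) R → deleteK (padK m R) ≡ R
    deleteK-padK {R} m R≤k = begin
      deleteK (R ++ replicate (m ∸ length R) K)           ≡⟨ filter-++ (_≤? k) R _ ⟩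
      deleteK R ++ deleteK (replicate (m ∸ length R) K)       ≡⟨ cong₂ _++_ (filter-all (_≤? k) R≤k) (deleteK-none (All.replicate⁺ (m ∸ length R) ≤-refl)) ⟩
      R ++ []                                          ≡⟨ ++-identityʳ R ⟩
      R                                                ∎
      where open ≡-Reasoning

    length-padK : ∀ {R m} → length R ≤ m → length (padK m R) ≡ m
    length-padK {R} {m} R≤m = trans (length-++ R) (trans (cong (length R +_) (length-replicate (m ∸ length R))) (m+[n∸m]≡n R≤m))

    sorted-padK : ∀ {R} m → Sorted R → All (_≤ k) R → Sorted (padK m R)
    sorted-padK {R} m s R≤k = sorted-++-replicate s R≤k (m ∸ length R)
      where
      replicate-sorted : ∀ c → Sorted (replicate c K)
      replicate-sorted zero          = []
      replicate-sorted (suc zero)    = [-]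
      replicate-sorted (suc (suc c)) = ≤-refl ∷ replicate-sorted (suc c)
      sorted-++-replicate : ∀ {R} → Sorted R → All (_≤ k) R → ∀ c → Sorted (R ++ replicate c K)
      sorted-++-replicate {[]}        _         _          c       = replicate-sorted c
      sorted-++-replicate {x ∷ []}    _         _          zero    = [-]
      sorted-++-replicate {x ∷ []}    _         (x≤k ∷ []) (suc c) = m≤n⇒m≤1+n x≤k ∷ replicate-sorted (suc c)
      sorted-++-replicate {x ∷ y ∷ R} (x≤y ∷ s) (_ ∷ R≤k)  c       = x≤y ∷ sorted-++-replicate s R≤k c

    occ-padK : ∀ {i R} m → i ≤ k → All (_≤ k) R → occ i (padK m R) ≡ occ i R
    occ-padK {i} {R} m i≤k R≤k = begin
      occ i (R ++ replicate (m ∸ length R) K)        ≡⟨ ∑-++ R _ _ ⟩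
      occ i R + occ i (replicate (m ∸ length R) K)   ≡⟨ cong (occ i R +_) (occ-none (All.replicate⁺ (m ∸ length R) (λ { refl → <-irrefl refl (s≤s i≤k) }))) ⟩
      occ i R + 0                                    ≡⟨ +-identityʳ _ ⟩
      occ i R                                        ∎
      where open ≡-Reasoning

    occ-K-padK : ∀ {R} m → All (_≤ k) R → occ K (padK m R) ≡ m ∸ length R
    occ-K-padK {R} m R≤k = begin
      occ K (R ++ replicate (m ∸ length R) K)        ≡⟨ ∑-++ R _ _ ⟩
      occ K R + occ K (replicate (m ∸ length R) K)   ≡⟨ cong₂ _+_ (occ-none (All.map (λ x≤k → λ { refl → <-irrefl refl (s≤s x≤k) }) R≤k)) (occ-replicate _ K) ⟩
      m ∸ length R                                   ∎
      where open ≡-Reasoning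

    padK-entries : ∀ {R} m → All (_∈ oneTo k) R → All (_∈ oneTo K) (padK m R)
    padK-entries m R⊆ = All.++⁺ (All.map widen R⊆) (All.replicate⁺ _ (oneTo-∈⁺ (s≤s z≤n) ≤-refl))
      where
      widen : ∀ {x} → x ∈ oneTo k → x ∈ oneTo K
      widen x∈ = let 1≤x , x≤k = oneTo-∈⁻ x∈ in oneTo-∈⁺ 1≤x (m≤n⇒m≤1+n x≤k)

    column-padK : ∀ {R₁ R₂} m₁ m₂ → ColStrict R₁ R₂ → All (_≤ k) R₁ → length R₂ ≤ m₂ → m₂ ≤ length R₁ →
                 ColStrict (padK m₁ R₁) (padK m₂ R₂)
    column-padK {R₁} {R₂} m₁ m₂ c R₁≤k R₂≤m₂ m₂≤R₁ =
      column-++ c R₁≤k (subst (_≤ length R₁) (sym (m+[n∸m]≡n R₂≤m₂)) m₂≤R₁)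
      where
      column-replicate : ∀ {R₁} X c₂ → All (_≤ k) R₁ → c₂ ≤ length R₁ → ColStrict (R₁ ++ X) (replicate c₂ K)
      column-replicate X zero     _            _           = tt
      column-replicate X (suc c₂) (x≤k ∷ R₁≤k) (s≤s c₂≤R₁) = s≤s x≤k , column-replicate X c₂ R₁≤k c₂≤R₁
      column-++ : ∀ {R₁ R₂ c₁ c₂} → ColStrict R₁ R₂ → All (_≤ k) R₁ → length R₂ + c₂ ≤ length R₁ →
                  ColStrict (R₁ ++ replicate c₁ K) (R₂ ++ replicate c₂ K)
      column-++ {R₁}     {[]}     {c₁} {c₂} _         R₁≤k         le       = column-replicate _ c₂ R₁≤k le
      column-++ {x ∷ R₁} {y ∷ R₂}           (x<y , c) (_ ∷ R₁≤k) (s≤s le) = x<y , column-++ c R₁≤k le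

module BranchingRule where

  open import Data.Nat using (ℕ; zero; suc; _+_; _*_; _∸_; _≤_; _≤?_; _≟_; z≤n)
  open import Data.Nat.Properties using (≤-trans; +-comm; m+[n∸m]≡n; +-cancelˡ-≡)
  open import Data.Nat.Tactic.RingSolver using (solve-∀)
  open import Data.Nat.ListAction using (sum)
  open import Data.List using (List; []; _∷_; map; concat; length; zipWith; _∷ʳ_)
  open import Data.List.Properties using (map-++; map-cong-local; length-++; ∷ʳ-injective)
  open import Data.List.Membership.Propositional using (_∈_)
  open import Data.List.Relation.Unary.All using (All; []; _∷_)
  import Data.List.Relation.Unary.All as All
  import Data.List.Relation.Unary.All.Properties as All
  open import Data.List.Relation.Unary.Linked using (Linked; []; [-]; _∷_)
  open import Data.List.Relation.Binary.Pointwise using ([]; _∷_)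
  open import Data.Product using (_×_; _,_; proj₁; proj₂)
  open import Data.Unit using (⊤; tt)
  open import Data.Empty using (⊥; ⊥-elim)
  open import Relation.Nullary using (Dec; yes; no; ¬_)
  open import Relation.Nullary.Decidable using (_×-dec_)
  open import Relation.Binary.PropositionalEquality using (_≡_; refl; sym; trans; cong; cong₂; module ≡-Reasoning)
  open import Defs
  open FiniteSums
  open Enumerations
  open Tableaux

  hd₀ : List ℕ → ℕ
  hd₀ []      = 0
  hd₀ (x ∷ _) = x

  -- μ/ν is a horizontal strip: ν_i ≤ μ_i and μ_{i+1} ≤ ν_i, for lists of equal length (zero parts allowed).
  HStrip : List ℕ → List ℕ → Set
  HStrip []      []      = ⊤
  HStrip (m ∷ μ) (v ∷ ν) = (v ≤ m) × (hd₀ μ ≤ v) × HStrip μ ν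
  HStrip []      (_ ∷ _) = ⊥
  HStrip (_ ∷ _) []      = ⊥

  hstrip? : ∀ μ ν → Dec (HStrip μ ν)
  hstrip? []      []      = yes tt
  hstrip? (m ∷ μ) (v ∷ ν) = (v ≤? m) ×-dec ((hd₀ μ ≤? v) ×-dec hstrip? μ ν)
  hstrip? []      (_ ∷ _) = no λ ()
  hstrip? (_ ∷ _) []      = no λ ()

  Strip : ℕ → List ℕ → List ℕ → Set
  Strip a μ ν = HStrip μ ν × (sum μ ≡ sum ν + a)

  strip? : ∀ a μ ν → Dec (Strip a μ ν)
  strip? a μ ν = hstrip? μ ν ×-dec (sum μ ≟ sum ν + a)

  module Restriction (k : ℕ) where
    open Rows k

    shape : List (List ℕ) → List ℕ
    shape = map (λ R → length (deleteK R))

    restrict : List (List ℕ) → List (List ℕ)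
    restrict = map deleteK

    extend : List ℕ → List (List ℕ) → List (List ℕ)
    extend = zipWith padK

    BoundedBy : ℕ → List (List ℕ) → Set
    BoundedBy b = All (All (_≤ b))

    restrict-filling : ∀ {μ T} → IsFilling μ K T → IsFilling (shape T) k (restrict T)
    restrict-filling               []                = []
    restrict-filling {T = R ∷ _} ((_ , R⊆) ∷ fill) =
      (refl , All.zipWith (λ (x∈ , x≤k) → oneTo-∈⁺ (proj₁ (oneTo-∈⁻ x∈)) x≤k) (All.filter⁺ (_≤? k) R⊆ , All.all-filter (_≤? k) R))
      ∷ restrict-filling fill

    shape-bounded : ∀ {N μ T} → All (_≤ N) μ → IsFilling μ K T → shape T ∈ boundedLists N (length μ)
    shape-bounded {N} μ≤N fill = ∈-boundedLists⁺ (shape≤ μ≤N fill) (length-shape fill)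
      where
      shape≤ : ∀ {μ T} → All (_≤ N) μ → IsFilling μ K T → All (_≤ N) (shape T)
      shape≤ {T = []}    []          []                  = []
      shape≤ {T = R ∷ _} (m≤N ∷ μ≤N) ((refl , _) ∷ fill) = ≤-trans (length-deleteK≤ R) m≤N ∷ shape≤ μ≤N fill
      length-shape : ∀ {μ T} → IsFilling μ K T → length (shape T) ≡ length μ
      length-shape []         = refl
      length-shape (_ ∷ fill) = cong suc (length-shape fill)

    restrict-strip : ∀ {μ T} → IsFilling μ K T → Linked ColStrict T → BoundedBy K T → HStrip μ (shape T)
    restrict-strip []                _ []           = tt
    restrict-strip {T = R ∷ []}      ((refl , _) ∷ []) _ _ = length-deleteK≤ R , z≤n , tt
    restrict-strip {T = R ∷ R′ ∷ T} ((refl , _) ∷ fill@((refl , _) ∷ _)) (c ∷ cs) (_ ∷ R′≤K ∷ T≤K) =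
      length-deleteK≤ R , column-length c R′≤K , restrict-strip fill cs (R′≤K ∷ T≤K)

    restrict-size : ∀ {μ T} → IsFilling μ K T → BoundedBy K T → sum μ ≡ sum (shape T) + ∑ T (occ K)
    restrict-size [] [] = refl
    restrict-size {T = R ∷ T} ((refl , _) ∷ fill) (R≤K ∷ T≤K) =
      trans (cong₂ _+_ (length-split R≤K) (restrict-size fill T≤K))
            (interchange (length (deleteK R)) (occ K R) (sum (shape T)) (∑ T (occ K)))
      where
      interchange : ∀ a b c d → (a + b) + (c + d) ≡ (a + c) + (b + d)
      interchange = solve-∀

    restrict-ssyt : ∀ {T} → IsSSYT T → IsSSYT (restrict T)
    restrict-ssyt (sorted , cols) = All.map⁺ (All.map sorted-deleteK sorted) , columns sorted cols
      where
      columns : ∀ {T} → All Sorted T → Linked ColStrict T → Linked ColStrict (restrict T)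
      columns _             []       = []
      columns _             [-]      = [-]
      columns (_ ∷ s′ ∷ ss) (c ∷ cs) = deleteK-column s′ c ∷ columns (s′ ∷ ss) cs

    restrict-occ : ∀ {i} T → i ≤ k → ∑ (restrict T) (occ i) ≡ ∑ T (occ i)
    restrict-occ {i} T i≤k = trans (∑-map deleteK T (occ i)) (∑-cong T (λ R → occ-deleteK R i≤k))

    extend-restrict : ∀ {μ T} → IsFilling μ K T → All Sorted T → BoundedBy K T → extend μ (restrict T) ≡ T
    extend-restrict []                  []       []          = refl
    extend-restrict ((refl , _) ∷ fill) (s ∷ ss) (R≤K ∷ T≤K) = cong₂ _∷_ (padK-deleteK s R≤K) (extend-restrict fill ss T≤K)

    row≤k : ∀ {R} → All (_∈ oneTo k) R → All (_≤ k) R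
    row≤k = All.map (λ x∈ → proj₂ (oneTo-∈⁻ x∈))

    extend-filling : ∀ {μ ν T′} → HStrip μ ν → IsFilling ν k T′ → IsFilling μ K (extend μ T′)
    extend-filling {[]}    {[]}    _             []                    = []
    extend-filling {m ∷ _} {_ ∷ _} {R ∷ _} (v≤m , _ , st) ((refl , R⊆) ∷ fill) =
      (length-padK {R} v≤m , padK-entries m R⊆) ∷ extend-filling st fill

    extend-sorted : ∀ {μ ν T′} → IsFilling ν k T′ → All Sorted T′ → All Sorted (extend μ T′)
    extend-sorted {[]}    _                  _        = []
    extend-sorted {_ ∷ _} []                 []       = []
    extend-sorted {m ∷ _} ((_ , R⊆) ∷ fill) (s ∷ ss) = sorted-padK m s (row≤k R⊆) ∷ extend-sorted fill ss

    extend-columns : ∀ {μ ν T′} → HStrip μ ν → IsFilling ν k T′ → Linked ColStrict T′ → Linked ColStrict (extend μ T′)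
    extend-columns {[]}    {[]}    _ [] [] = []
    extend-columns {_ ∷ []} {_ ∷ []} _ (_ ∷ []) [-] = [-]
    extend-columns {m₁ ∷ m₂ ∷ μ} {_ ∷ _ ∷ _} (_ , m₂≤v₁ , st@(v₂≤m₂ , _)) ((refl , R₁⊆) ∷ fill@((refl , _) ∷ _)) (c ∷ cs) =
      column-padK m₁ m₂ c (row≤k R₁⊆) v₂≤m₂ m₂≤v₁ ∷ extend-columns st fill cs

    extend-occ : ∀ {i μ ν T′} → i ≤ k → HStrip μ ν → IsFilling ν k T′ → ∑ (extend μ T′) (occ i) ≡ ∑ T′ (occ i)
    extend-occ {μ = []}    {[]}    _   _            []                   = refl
    extend-occ {μ = m ∷ _} {_ ∷ _} i≤k (_ , _ , st) ((_ , R⊆) ∷ fill) =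
      cong₂ _+_ (occ-padK m i≤k (row≤k R⊆)) (extend-occ i≤k st fill)

    extend-occ-K : ∀ {μ ν T′} → HStrip μ ν → IsFilling ν k T′ → ∑ (extend μ T′) (occ K) + sum ν ≡ sum μ
    extend-occ-K {[]}    {[]}    _              []                    = refl
    extend-occ-K {m ∷ μ} {v ∷ ν} {R ∷ T′} (v≤m , _ , st) ((refl , R⊆) ∷ fill) = begin
      (occ K (padK m R) + ∑ (extend μ T′) (occ K)) + (v + sum ν)  ≡⟨ cong (λ o → (o + _) + _) (occ-K-padK m (row≤k R⊆)) ⟩
      (m ∸ v + ∑ (extend μ T′) (occ K)) + (v + sum ν)            ≡⟨ interchange (m ∸ v) _ v (sum ν) ⟩
      (m ∸ v + v) + (∑ (extend μ T′) (occ K) + sum ν)            ≡⟨ cong₂ _+_ (trans (+-comm (m ∸ v) v) (m+[n∸m]≡n v≤m)) (extend-occ-K st fill) ⟩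
      m + sum μ                                                  ∎
      where
      open ≡-Reasoning
      interchange : ∀ a b c d → (a + b) + (c + d) ≡ (a + c) + (b + d)
      interchange = solve-∀

    restrict-extend : ∀ {μ ν T′} → HStrip μ ν → IsFilling ν k T′ → (shape (extend μ T′) ≡ ν) × (restrict (extend μ T′) ≡ T′)
    restrict-extend {[]}    {[]}    _             []                   = refl , refl
    restrict-extend {m ∷ _} {_ ∷ _} {R ∷ _} (_ , _ , st) ((refl , R⊆) ∷ fill) =
      let shape≡ , restrict≡ = restrict-extend st fill
          low≡ = deleteK-padK m (row≤k R⊆)
      in cong₂ _∷_ (cong length low≡) shape≡ , cong₂ _∷_ low≡ restrict≡

  contentVector : ℕ → List (List ℕ) → List ℕ
  contentVector k T = map (λ i → count i (concat T)) (oneTo k)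

  count-concat : ∀ i T → count i (concat T) ≡ ∑ T (occ i)
  count-concat i T = trans (count≡occ i (concat T)) (∑-concat T _)

  contentVector-∷ʳ : ∀ k T → contentVector (suc k) T ≡ contentVector k T ∷ʳ count (suc k) (concat T)
  contentVector-∷ʳ k T = trans (cong (map _) (oneTo-∷ʳ k)) (map-++ _ (oneTo k) (suc k ∷ []))

  contentVector-cong : ∀ k {T T′} → (∀ {i} → i ≤ k → ∑ T (occ i) ≡ ∑ T′ (occ i)) → contentVector k T ≡ contentVector k T′
  contentVector-cong k {T} {T′} eq = map-cong-local (All.tabulate (λ i∈ →
    trans (count-concat _ T) (trans (eq (proj₂ (oneTo-∈⁻ i∈))) (sym (count-concat _ T′)))))

  length-∷ʳ : ∀ (α : List ℕ) a → length (α ∷ʳ a) ≡ suc (length α)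
  length-∷ʳ α a = trans (length-++ α) (+-comm (length α) 1)

  hasContent-∷ʳ⁻ : ∀ {α a T} → HasContent (α ∷ʳ a) T →
                   All (InRange (suc (length α))) T × (contentVector (length α) T ≡ α) × (count (suc (length α)) (concat T) ≡ a)
  hasContent-∷ʳ⁻ {α} {a} {T} (entries , content) rewrite length-∷ʳ α a =
    let split = ∷ʳ-injective _ α (trans (sym (contentVector-∷ʳ (length α) T)) content)
    in entries , split

  hasContent-∷ʳ⁺ : ∀ {α a T} → All (InRange (suc (length α))) T → contentVector (length α) T ≡ α → count (suc (length α)) (concat T) ≡ a →
                   HasContent (α ∷ʳ a) T
  hasContent-∷ʳ⁺ {α} {a} {T} entries content count≡a rewrite length-∷ʳ α a =
    entries , trans (contentVector-∷ʳ (length α) T) (cong₂ _∷ʳ_ content count≡a)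

  TableauOfContent : List ℕ → List (List ℕ) → Set
  TableauOfContent α T = IsSSYT T × HasContent α T

  tableauOfContent? : ∀ α T → Dec (TableauOfContent α T)
  tableauOfContent? α T = isSSYT? T ×-dec hasContent? α T

  -- Deleting the largest entry, length α + 1, from a tableau of content α ∷ʳ a leaves a tableau of
  -- content α whose shape ν makes μ/ν a horizontal strip of size a; padding rows inverts this.
  module StripBijection {N : ℕ} (μ α : List ℕ) (a : ℕ) (μ≤N : All (_≤ N) μ) where

    private
      k = length α
    open Rows k
    open Restriction k

    StripTableau : List ℕ × List (List ℕ) → Set
    StripTableau (ν , T′) = Strip a μ ν × TableauOfContent α T′

    stripTableau? : ∀ p → Dec (StripTableau p)
    stripTableau? (ν , T′) = strip? a μ ν ×-dec tableauOfContent? α T′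

    shapesAndFillings : List (List ℕ × List (List ℕ))
    shapesAndFillings = pairs (boundedLists N (length μ)) (λ ν → fillings ν k)

    restrict-sound : ∀ {T} → T ∈ fillings μ K → TableauOfContent (α ∷ʳ a) T →
                     ((shape T , restrict T) ∈ shapesAndFillings) × StripTableau (shape T , restrict T) × (extend μ (restrict T) ≡ T)
    restrict-sound {T} T∈ (ssyt@(sorted , cols) , content) =
      ∈-pairs⁺ (shape-bounded μ≤N fill) (∈-fillings⁺ _ k fill′) ,
      ((restrict-strip fill cols T≤K , size) , restrict-ssyt ssyt , filling-entries fill′ , content′) ,
      extend-restrict fill sorted T≤K
      where
      fill = ∈-fillings⁻ μ K T∈
      fill′ = restrict-filling fill
      decomposed = hasContent-∷ʳ⁻ {α} content
      T≤K : BoundedBy K T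
      T≤K = All.map (All.map proj₂) (proj₁ decomposed)
      size : sum μ ≡ sum (shape T) + a
      size = trans (restrict-size fill T≤K) (cong (sum (shape T) +_) (trans (sym (count-concat K T)) (proj₂ (proj₂ decomposed))))
      content′ : contentVector k (restrict T) ≡ α
      content′ = trans (contentVector-cong k {restrict T} {T} (λ i≤k → restrict-occ T i≤k)) (proj₁ (proj₂ decomposed))

    extend-sound : ∀ {p} → p ∈ shapesAndFillings → StripTableau p →
                   (extend μ (proj₂ p) ∈ fillings μ K) × TableauOfContent (α ∷ʳ a) (extend μ (proj₂ p)) ×
                   ((shape (extend μ (proj₂ p)) , restrict (extend μ (proj₂ p))) ≡ p)
    extend-sound {ν , T′} p∈ ((hstrip , size) , (sorted , cols) , _ , vector) =
      ∈-fillings⁺ μ K fill′ ,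
      ((extend-sorted fill sorted , extend-columns hstrip fill cols) ,
       hasContent-∷ʳ⁺ {α} (filling-entries fill′) content′ count≡a) ,
      cong₂ _,_ (proj₁ (restrict-extend hstrip fill)) (proj₂ (restrict-extend hstrip fill))
      where
      fill = ∈-fillings⁻ ν k (proj₂ (∈-pairs⁻ {xs = boundedLists N (length μ)} {ys = λ ν → fillings ν k} p∈))
      fill′ = extend-filling hstrip fill
      content′ : contentVector k (extend μ T′) ≡ α
      content′ = trans (contentVector-cong k {extend μ T′} {T′} (λ i≤k → extend-occ i≤k hstrip fill)) vector
      count≡a : count K (concat (extend μ T′)) ≡ a
      count≡a = trans (count-concat K (extend μ T′))
        (+-cancelˡ-≡ (sum ν) _ _ (trans (+-comm (sum ν) _) (trans (extend-occ-K hstrip fill) size)))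

    count-tableaux : ∑ (fillings μ K) (λ T → 𝟙 (tableauOfContent? (α ∷ʳ a) T)) ≡ ∑ shapesAndFillings (λ p → 𝟙 (stripTableau? p))
    count-tableaux = ∑𝟙-bijection (fillings-unique μ K) (pairs-unique (boundedLists-unique N (length μ)) (λ ν → fillings-unique ν k))
      (tableauOfContent? (α ∷ʳ a)) stripTableau? (λ T → shape T , restrict T) (λ (_ , T′) → extend μ T′) restrict-sound extend-sound

  kostka-∷ʳ : ∀ {N} μ α a → All (_≤ N) μ →
              kostka μ (α ∷ʳ a) ≡ ∑ (boundedLists N (length μ)) (λ ν → 𝟙 (strip? a μ ν) * kostka ν α)
  kostka-∷ʳ {N} μ α a μ≤N = begin
    kostka μ (α ∷ʳ a)
      ≡⟨ length-filter≡∑𝟙 (tableauOfContent? (α ∷ʳ a)) (fillings μ (length (α ∷ʳ a))) ⟩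
    ∑ (fillings μ (length (α ∷ʳ a))) (λ T → 𝟙 (tableauOfContent? (α ∷ʳ a) T))
      ≡⟨ cong (λ L → ∑ (fillings μ L) (λ T → 𝟙 (tableauOfContent? (α ∷ʳ a) T))) (length-∷ʳ α a) ⟩
    ∑ (fillings μ (suc (length α))) (λ T → 𝟙 (tableauOfContent? (α ∷ʳ a) T))
      ≡⟨ count-tableaux ⟩
    ∑ shapesAndFillings (λ p → 𝟙 (stripTableau? p))
      ≡⟨ ∑-pairs shapes (λ ν → fillings ν (length α)) (λ p → 𝟙 (stripTableau? p)) ⟩
    ∑ shapes (λ ν → ∑ (fillings ν (length α)) (λ T′ → 𝟙 (stripTableau? (ν , T′))))
      ≡⟨ ∑-cong shapes (λ ν → trans (∑-cong (fillings ν (length α)) (λ T′ → 𝟙-× (strip? a μ ν) (tableauOfContent? α T′)))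
                                    (∑-*ˡ (fillings ν (length α)) (𝟙 (strip? a μ ν)) _)) ⟩
    ∑ shapes (λ ν → 𝟙 (strip? a μ ν) * ∑ (fillings ν (length α)) (λ T′ → 𝟙 (tableauOfContent? α T′)))
      ≡⟨ ∑-cong shapes (λ ν → cong (𝟙 (strip? a μ ν) *_) (length-filter≡∑𝟙 (tableauOfContent? α) (fillings ν (length α)))) ⟨
    ∑ shapes (λ ν → 𝟙 (strip? a μ ν) * kostka ν α)
      ∎
    where
    open ≡-Reasoning
    open StripBijection μ α a μ≤N
    shapes = boundedLists N (length μ)

  emptyRows : List ℕ → List (List ℕ)
  emptyRows μ = map (λ _ → []) μ

  fillings-zero : ∀ μ → All (_≡ 0) μ → fillings μ 0 ≡ emptyRows μ ∷ []
  fillings-zero []      []           = refl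
  fillings-zero (0 ∷ μ) (refl ∷ μ≡0) rewrite fillings-zero μ μ≡0 = refl

  fillings-nonzero : ∀ μ → ¬ All (_≡ 0) μ → fillings μ 0 ≡ []
  fillings-nonzero []          μ≢0 = ⊥-elim (μ≢0 [])
  fillings-nonzero (suc m ∷ μ) μ≢0 = refl
  fillings-nonzero (zero ∷ μ)  μ≢0 rewrite fillings-nonzero μ (λ μ≡0 → μ≢0 (refl ∷ μ≡0)) = refl

  kostka-[] : ∀ μ → kostka μ [] ≡ 𝟙 (All.all? (_≟ 0) μ)
  kostka-[] μ with All.all? (_≟ 0) μ
  ... | yes μ≡0 rewrite fillings-zero μ μ≡0 =
    trans (length-filter≡∑𝟙 (tableauOfContent? []) (emptyRows μ ∷ []))
          (cong (_+ 0) (𝟙-yes (tableauOfContent? [] (emptyRows μ)) (ssyt μ , entries μ , refl)))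
    where
    ssyt : ∀ μ → IsSSYT (emptyRows μ)
    ssyt []          = [] , []
    ssyt (_ ∷ [])    = [] ∷ [] , [-]
    ssyt (_ ∷ m ∷ μ) = let sorted , cols = ssyt (m ∷ μ) in [] ∷ sorted , tt ∷ cols
    entries : ∀ μ → All (InRange 0) (emptyRows μ)
    entries []      = []
    entries (_ ∷ μ) = [] ∷ entries μ
  ... | no μ≢0 rewrite fillings-nonzero μ μ≢0 = refl

module ContentSymmetry where

  open import Data.Nat using (ℕ; suc; pred; _+_; _*_; _∸_; _≤_; _⊔_; _⊓_; z≤n)
  open import Data.Nat.Properties using (≤-trans; ≤-reflexive; ≤-total; +-comm; *-assoc; +-cancelʳ-≡; m≤n⇒m⊔n≡n; m≥n⇒m⊔n≡m; m≤n⇒m⊓n≡m; m≥n⇒m⊓n≡n; m⊓n≤m; m⊓n≤n; m≤m⊔n; m≤n⊔m; ⊔-lub; ⊓-glb; ⊓-idem; m∸[m∸n]≡n; m∸n+n≡m; ∸-monoʳ-≤; m+n∸n≡m; m≤n+m)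
  open import Data.Nat.Tactic.RingSolver using (solve-∀)
  open import Data.Nat.ListAction using (sum)
  open import Data.List using (List; []; _∷_; length; reverse)
  open import Data.List.Properties using (unfold-reverse; reverse-involutive)
  open import Data.List.Membership.Propositional using (_∈_)
  open import Data.List.Relation.Unary.All using (All; []; _∷_)
  open import Data.List.Relation.Binary.Permutation.Propositional as ↭ using (_↭_; prep; swap)
  open import Data.List.Relation.Binary.Permutation.Propositional.Properties using (↭-reverse)
  open import Data.Product using (_×_; _,_; proj₁; proj₂)
  open import Data.Sum using (inj₁; inj₂)
  open import Data.Unit using (⊤; tt)
  open import Data.Empty using (⊥)
  open import Relation.Nullary.Decidable using (_×-dec_)
  open import Relation.Binary.PropositionalEquality using (_≡_; refl; sym; trans; cong; cong₂; module ≡-Reasoning)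
  open import Defs
  open FiniteSums
  open Enumerations
  open BranchingRule

  ⊔-+-⊓ : ∀ a b → (a ⊔ b) + (a ⊓ b) ≡ a + b
  ⊔-+-⊓ a b with ≤-total a b
  ... | inj₁ a≤b rewrite m≤n⇒m⊔n≡n a≤b | m≤n⇒m⊓n≡m a≤b = +-comm b a
  ... | inj₂ b≤a rewrite m≥n⇒m⊔n≡m b≤a | m≥n⇒m⊓n≡n b≤a = refl

  hstrip-length : ∀ {μ ν} → HStrip μ ν → length μ ≡ length ν
  hstrip-length {[]}    {[]}    _            = refl
  hstrip-length {_ ∷ _} {_ ∷ _} (_ , _ , st) = cong suc (hstrip-length st)

  hstrip-hd : ∀ {μ ν} → HStrip μ ν → hd₀ ν ≤ hd₀ μ
  hstrip-hd {[]}    {[]}    _           = z≤n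
  hstrip-hd {_ ∷ _} {_ ∷ _} (v≤m , _ , _) = v≤m

  -- Each ν_i lies in [μ_{i+1} ⊔ ρ_i , μ_i ⊓ b_i], where b_0 = b and b_{i+1} = ρ_i; for ν_0 ≤ b this says
  -- exactly that μ/ν and ν/ρ are horizontal strips.
  Sandwiched : ℕ → List ℕ → List ℕ → List ℕ → Set
  Sandwiched b []       []       []       = ⊤
  Sandwiched b (m ∷ ms) (v ∷ vs) (p ∷ ps) = (hd₀ ms ⊔ p ≤ v) × (v ≤ m ⊓ b) × Sandwiched p ms vs ps
  Sandwiched b []       []       (_ ∷ _)  = ⊥
  Sandwiched b []       (_ ∷ _)  _        = ⊥
  Sandwiched b (_ ∷ _)  []       _        = ⊥
  Sandwiched b (_ ∷ _)  (_ ∷ _)  []       = ⊥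

  -- Reflecting each ν_i in its interval exchanges the sizes of μ/ν and ν/ρ (a Bender–Knuth involution on shapes).
  reflect : ℕ → List ℕ → List ℕ → List ℕ → List ℕ
  reflect b (m ∷ ms) (p ∷ ps) (v ∷ vs) = (hd₀ ms ⊔ p) + (m ⊓ b) ∸ v ∷ reflect p ms ps vs
  reflect b _        _        _        = []

  intervalSum : ℕ → List ℕ → List ℕ → ℕ
  intervalSum b (m ∷ ms) (p ∷ ps) = (hd₀ ms ⊔ p) + (m ⊓ b) + intervalSum p ms ps
  intervalSum b _        _        = 0

  module _ {l h v : ℕ} (l≤v : l ≤ v) (v≤h : v ≤ h) where

    reflect-lower : l ≤ l + h ∸ v
    reflect-lower = ≤-trans (≤-reflexive (sym (m+n∸n≡m l h))) (∸-monoʳ-≤ (l + h) v≤h)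

    reflect-upper : l + h ∸ v ≤ h
    reflect-upper = ≤-trans (∸-monoʳ-≤ (l + h) l≤v) (≤-reflexive (trans (cong (_∸ l) (+-comm l h)) (m+n∸n≡m h l)))

    v≤l+h : v ≤ l + h
    v≤l+h = ≤-trans v≤h (m≤n+m h l)

  sandwiched-reflect : ∀ b μ ν ρ → Sandwiched b μ ν ρ → Sandwiched b μ (reflect b μ ρ ν) ρ
  sandwiched-reflect b []       []       []       tt            = tt
  sandwiched-reflect b (m ∷ ms) (v ∷ vs) (p ∷ ps) (l≤v , v≤h , s) =
    reflect-lower l≤v v≤h , reflect-upper l≤v v≤h , sandwiched-reflect p ms vs ps s

  reflect-involutive : ∀ b μ ν ρ → Sandwiched b μ ν ρ → reflect b μ ρ (reflect b μ ρ ν) ≡ ν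
  reflect-involutive b []       []       []       tt            = refl
  reflect-involutive b (m ∷ ms) (v ∷ vs) (p ∷ ps) (l≤v , v≤h , s) =
    cong₂ _∷_ (m∸[m∸n]≡n (v≤l+h l≤v v≤h)) (reflect-involutive p ms vs ps s)

  reflect-sum : ∀ b μ ν ρ → Sandwiched b μ ν ρ → sum (reflect b μ ρ ν) + sum ν ≡ intervalSum b μ ρ
  reflect-sum b []       []       []       tt            = refl
  reflect-sum b (m ∷ ms) (v ∷ vs) (p ∷ ps) (l≤v , v≤h , s) =
    trans (interchange ((hd₀ ms ⊔ p) + (m ⊓ b) ∸ v) (sum (reflect p ms ps vs)) v (sum vs))
          (cong₂ _+_ (m∸n+n≡m (v≤l+h l≤v v≤h)) (reflect-sum p ms vs ps s))
    where
    interchange : ∀ a b c d → (a + b) + (c + d) ≡ (a + c) + (b + d)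
    interchange = solve-∀

  -- Telescoping: the maxima (μ_{i+1} ⊔ ρ_i) pair up with the minima (μ_{i+1} ⊓ ρ_i) of the next row.
  intervalSum-telescopes : ∀ b μ ρ → length μ ≡ length ρ → intervalSum b μ ρ + hd₀ μ ≡ (hd₀ μ ⊓ b) + sum μ + sum ρ
  intervalSum-telescopes b []       []       _   = refl
  intervalSum-telescopes b (m ∷ ms) (p ∷ ps) len = +-cancelʳ-≡ (hd₀ ms) _ _ (begin
    X + mb + S + m + h                         ≡⟨ step₁ X mb S m h ⟩
    (X + mb + m) + (S + h)                     ≡⟨ cong ((X + mb + m) +_) (intervalSum-telescopes p ms ps (cong pred len)) ⟩
    (X + mb + m) + (Y + sum ms + sum ps)       ≡⟨ step₂ X mb m Y (sum ms) (sum ps) ⟩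
    (X + Y) + (mb + m + sum ms + sum ps)       ≡⟨ cong (_+ (mb + m + sum ms + sum ps)) (⊔-+-⊓ h p) ⟩
    (h + p) + (mb + m + sum ms + sum ps)       ≡⟨ step₃ h p mb m (sum ms) (sum ps) ⟩
    mb + (m + sum ms) + (p + sum ps) + h       ∎)
    where
    open ≡-Reasoning
    h = hd₀ ms
    X = h ⊔ p
    Y = h ⊓ p
    mb = m ⊓ b
    S = intervalSum p ms ps
    step₁ : ∀ X mb S m h → X + mb + S + m + h ≡ (X + mb + m) + (S + h)
    step₁ = solve-∀
    step₂ : ∀ X mb m Y a c → (X + mb + m) + (Y + a + c) ≡ (X + Y) + (mb + m + a + c)
    step₂ = solve-∀
    step₃ : ∀ h p mb m a c → (h + p) + (mb + m + a + c) ≡ mb + (m + a) + (p + c) + h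
    step₃ = solve-∀

  reflect-bounded : ∀ {N} b μ ν ρ → Sandwiched b μ ν ρ → All (_≤ N) μ → All (_≤ N) (reflect b μ ρ ν) × (length (reflect b μ ρ ν) ≡ length μ)
  reflect-bounded b []       []       []       tt              []          = [] , refl
  reflect-bounded b (m ∷ ms) (v ∷ vs) (p ∷ ps) (l≤v , v≤h , s) (m≤N ∷ μ≤N) =
    let bounded , len = reflect-bounded p ms vs ps s μ≤N
    in ≤-trans (reflect-upper l≤v v≤h) (≤-trans (m⊓n≤m m b) m≤N) ∷ bounded , cong suc len

  strips⇒sandwiched : ∀ b μ ν ρ → hd₀ ν ≤ b → HStrip μ ν → HStrip ν ρ → Sandwiched b μ ν ρ
  strips⇒sandwiched b []       []       []       _   _                _                = tt
  strips⇒sandwiched b (m ∷ ms) (v ∷ vs) (p ∷ ps) v≤b (v≤m , ms≤v , s₁) (p≤v , vs≤p , s₂) =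
    ⊔-lub ms≤v p≤v , ⊓-glb v≤m v≤b , strips⇒sandwiched p ms vs ps vs≤p s₁ s₂

  sandwiched⇒strips : ∀ b μ ν ρ → Sandwiched b μ ν ρ → (hd₀ ν ≤ b) × HStrip μ ν × HStrip ν ρ
  sandwiched⇒strips b []       []       []       tt            = z≤n , tt , tt
  sandwiched⇒strips b (m ∷ ms) (v ∷ vs) (p ∷ ps) (l≤v , v≤h , s) =
    let vs≤p , s₁ , s₂ = sandwiched⇒strips p ms vs ps s
    in ≤-trans v≤h (m⊓n≤n m b) ,
       (≤-trans v≤h (m⊓n≤m m b) , ≤-trans (m≤m⊔n (hd₀ ms) p) l≤v , s₁) ,
       (≤-trans (m≤n⊔m (hd₀ ms) p) l≤v , vs≤p , s₂)

  exchange-sizes : ∀ {F V M R x y} → F + V ≡ M + R → M ≡ V + x → V ≡ R + y → (M ≡ F + y) × (F ≡ R + x)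
  exchange-sizes {F} {V} {M} {R} {x} {y} total refl refl = trans (swap₂ R y x) (cong (_+ y) (sym F≡R+x)) , F≡R+x
    where
    swap₂ : ∀ a b c → a + b + c ≡ a + c + b
    swap₂ = solve-∀
    regroup : ∀ a b c → a + b + c + a ≡ (a + c) + (a + b)
    regroup = solve-∀
    F≡R+x : F ≡ R + x
    F≡R+x = +-cancelʳ-≡ (R + y) F (R + x) (trans total (regroup R y x))

  stripPairs : ℕ → List ℕ → List ℕ → ℕ → ℕ → ℕ
  stripPairs N μ ρ x y = ∑ (boundedLists N (length μ)) (λ ν → 𝟙 (strip? x μ ν ×-dec strip? y ν ρ))

  module _ {N : ℕ} {μ ρ : List ℕ} (μ≤N : All (_≤ N) μ) where

    private
      shapes = boundedLists N (length μ)
      φ = reflect (hd₀ μ) μ ρ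

    reflect-swaps : ∀ x y {ν} → ν ∈ shapes → Strip x μ ν × Strip y ν ρ →
                    (φ ν ∈ shapes) × (Strip y μ (φ ν) × Strip x (φ ν) ρ) × (φ (φ ν) ≡ ν)
    reflect-swaps x y {ν} _ ((s₁ , size₁) , (s₂ , size₂)) =
      ∈-boundedLists⁺ (proj₁ bounded) (proj₂ bounded) ,
      ((proj₁ (proj₂ strips) , proj₁ sizes) , (proj₂ (proj₂ strips) , proj₂ sizes)) ,
      reflect-involutive (hd₀ μ) μ ν ρ sandwich
      where
      sandwich = strips⇒sandwiched (hd₀ μ) μ ν ρ (hstrip-hd s₁) s₁ s₂
      strips = sandwiched⇒strips (hd₀ μ) μ (φ ν) ρ (sandwiched-reflect (hd₀ μ) μ ν ρ sandwich)
      bounded = reflect-bounded (hd₀ μ) μ ν ρ sandwich μ≤N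
      total : sum (φ ν) + sum ν ≡ sum μ + sum ρ
      total = trans (reflect-sum (hd₀ μ) μ ν ρ sandwich) (+-cancelʳ-≡ (hd₀ μ) _ _
        (trans (intervalSum-telescopes (hd₀ μ) μ ρ (trans (hstrip-length s₁) (hstrip-length s₂)))
               (trans (cong (λ h → h + sum μ + sum ρ) (⊓-idem (hd₀ μ))) (rotate (hd₀ μ) (sum μ) (sum ρ)))))
        where
        rotate : ∀ h a c → h + a + c ≡ a + c + h
        rotate = solve-∀
      sizes : (sum μ ≡ sum (φ ν) + y) × (sum (φ ν) ≡ sum ρ + x)
      sizes = exchange-sizes total size₁ size₂

    stripPairs-comm : ∀ x y → stripPairs N μ ρ x y ≡ stripPairs N μ ρ y x
    stripPairs-comm x y = ∑𝟙-bijection (boundedLists-unique N (length μ)) (boundedLists-unique N (length μ))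
      (λ ν → strip? x μ ν ×-dec strip? y ν ρ) (λ ν → strip? y μ ν ×-dec strip? x ν ρ) φ φ
      (reflect-swaps x y) (reflect-swaps y x)

  kostkaᴿ : List ℕ → List ℕ → ℕ
  kostkaᴿ μ α = kostka μ (reverse α)

  module _ {N : ℕ} where

    kostkaᴿ-∷ : ∀ {μ} a α → All (_≤ N) μ →
                kostkaᴿ μ (a ∷ α) ≡ ∑ (boundedLists N (length μ)) (λ ν → 𝟙 (strip? a μ ν) * kostkaᴿ ν α)
    kostkaᴿ-∷ {μ} a α μ≤N = trans (cong (kostka μ) (unfold-reverse a α)) (kostka-∷ʳ μ (reverse α) a μ≤N)

    kostkaᴿ-∷-∷ : ∀ {μ} x y zs → All (_≤ N) μ →
                  kostkaᴿ μ (x ∷ y ∷ zs) ≡ ∑ (boundedLists N (length μ)) (λ ρ → stripPairs N μ ρ x y * kostkaᴿ ρ zs)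
    kostkaᴿ-∷-∷ {μ} x y zs μ≤N = begin
      kostkaᴿ μ (x ∷ y ∷ zs)
        ≡⟨ kostkaᴿ-∷ x (y ∷ zs) μ≤N ⟩
      ∑ shapes (λ ν → 𝟙 (strip? x μ ν) * kostkaᴿ ν (y ∷ zs))
        ≡⟨ ∑-cong-local shapes (λ ν∈ → cong (𝟙 (strip? x μ _) *_) (second-strip ν∈)) ⟩
      ∑ shapes (λ ν → 𝟙 (strip? x μ ν) * ∑ shapes (λ ρ → 𝟙 (strip? y ν ρ) * kostkaᴿ ρ zs))
        ≡⟨ ∑-cong shapes (λ ν → sym (∑-*ˡ shapes (𝟙 (strip? x μ ν)) _)) ⟩
      ∑ shapes (λ ν → ∑ shapes (λ ρ → 𝟙 (strip? x μ ν) * (𝟙 (strip? y ν ρ) * kostkaᴿ ρ zs)))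
        ≡⟨ ∑-comm shapes shapes _ ⟩
      ∑ shapes (λ ρ → ∑ shapes (λ ν → 𝟙 (strip? x μ ν) * (𝟙 (strip? y ν ρ) * kostkaᴿ ρ zs)))
        ≡⟨ ∑-cong shapes (λ ρ → trans (∑-cong shapes (λ ν → regroup ν ρ)) (∑-*ʳ shapes _ (kostkaᴿ ρ zs))) ⟩
      ∑ shapes (λ ρ → stripPairs N μ ρ x y * kostkaᴿ ρ zs)
        ∎
      where
      open ≡-Reasoning
      shapes = boundedLists N (length μ)
      second-strip : ∀ {ν} → ν ∈ shapes → kostkaᴿ ν (y ∷ zs) ≡ ∑ shapes (λ ρ → 𝟙 (strip? y ν ρ) * kostkaᴿ ρ zs)
      second-strip {ν} ν∈ with ∈-boundedLists⁻ {N} {length μ} ν∈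
      ... | ν≤N , len = trans (kostkaᴿ-∷ y zs ν≤N) (cong (λ L → ∑ (boundedLists N L) (λ ρ → 𝟙 (strip? y ν ρ) * kostkaᴿ ρ zs)) len)
      regroup : ∀ ν ρ → 𝟙 (strip? x μ ν) * (𝟙 (strip? y ν ρ) * kostkaᴿ ρ zs) ≡ 𝟙 (strip? x μ ν ×-dec strip? y ν ρ) * kostkaᴿ ρ zs
      regroup ν ρ = trans (sym (*-assoc (𝟙 (strip? x μ ν)) _ _)) (cong (_* kostkaᴿ ρ zs) (sym (𝟙-× (strip? x μ ν) (strip? y ν ρ))))

    kostkaᴿ-↭ : ∀ {α β} → α ↭ β → ∀ {μ} → All (_≤ N) μ → kostkaᴿ μ α ≡ kostkaᴿ μ β
    kostkaᴿ-↭ ↭.refl         μ≤N = refl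
    kostkaᴿ-↭ (↭.trans p q)  μ≤N = trans (kostkaᴿ-↭ p μ≤N) (kostkaᴿ-↭ q μ≤N)
    kostkaᴿ-↭ (prep {xs} {ys} x p) {μ} μ≤N = begin
      kostkaᴿ μ (x ∷ xs)                                                   ≡⟨ kostkaᴿ-∷ x xs μ≤N ⟩
      ∑ shapes (λ ν → 𝟙 (strip? x μ ν) * kostkaᴿ ν xs)                     ≡⟨ ∑-cong-local shapes (λ ν∈ → cong (𝟙 (strip? x μ _) *_) (kostkaᴿ-↭ p (proj₁ (∈-boundedLists⁻ {N} {length μ} ν∈)))) ⟩
      ∑ shapes (λ ν → 𝟙 (strip? x μ ν) * kostkaᴿ ν ys)                     ≡⟨ kostkaᴿ-∷ x ys μ≤N ⟨
      kostkaᴿ μ (x ∷ ys)                                                   ∎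
      where
      open ≡-Reasoning
      shapes = boundedLists N (length μ)
    kostkaᴿ-↭ (swap {xs} {ys} x y p) {μ} μ≤N = begin
      kostkaᴿ μ (x ∷ y ∷ xs)                                               ≡⟨ kostkaᴿ-∷-∷ x y xs μ≤N ⟩
      ∑ shapes (λ ρ → stripPairs N μ ρ x y * kostkaᴿ ρ xs)                 ≡⟨ ∑-cong-local shapes (λ ρ∈ → cong₂ _*_ (stripPairs-comm μ≤N x y) (kostkaᴿ-↭ p (proj₁ (∈-boundedLists⁻ {N} {length μ} ρ∈)))) ⟩
      ∑ shapes (λ ρ → stripPairs N μ ρ y x * kostkaᴿ ρ ys)                 ≡⟨ kostkaᴿ-∷-∷ y x ys μ≤N ⟨
      kostkaᴿ μ (y ∷ x ∷ ys)                                               ∎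
      where
      open ≡-Reasoning
      shapes = boundedLists N (length μ)

    kostka-↭ : ∀ {μ α β} → All (_≤ N) μ → α ↭ β → kostka μ α ≡ kostka μ β
    kostka-↭ {μ} {α} {β} μ≤N α↭β = begin
      kostka μ α                      ≡⟨ cong (kostka μ) (reverse-involutive α) ⟨
      kostkaᴿ μ (reverse α)           ≡⟨ kostkaᴿ-↭ (↭.↭-trans (↭-reverse α) (↭.↭-trans α↭β (↭.↭-sym (↭-reverse β)))) μ≤N ⟩
      kostkaᴿ μ (reverse β)           ≡⟨ cong (kostka μ) (reverse-involutive β) ⟩
      kostka μ β                      ∎
      where open ≡-Reasoning

module RemovalWords where

  open import Data.Nat using (ℕ; zero; suc; pred; _+_; _*_; _≤_; _<_; _≤?_; _<?_; _≟_; z≤n; s≤s)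
  open import Data.Nat.Properties using (pred-mono-≤; ≤-refl; ≤-reflexive; ≤-trans; ≤-antisym; ≤-pred; +-identityʳ; +-assoc; +-suc; +-cancelˡ-≡; +-mono-≤; +-monoʳ-≤; +-cancelʳ-≤; ≤∧≢⇒<; suc-injective; pred[n]≤n; 1+n≰n; n≤1+n; n≤0⇒n≡0; *-identityʳ; *-assoc)
  open import Data.Nat.Tactic.RingSolver using (solve-∀)
  open import Data.Nat.ListAction using (sum)
  open import Data.Bool using (Bool; true; false)
  open import Data.List using (List; []; _∷_; map; length; upTo; take; drop; replicate; _++_)
  open import Data.List.Properties using (≡-dec; ∷-injective)
  open import Data.List.Membership.Propositional using (_∈_)
  open import Data.List.Relation.Unary.All using (All; []; _∷_)
  open import Data.List.Relation.Unary.Linked using (Linked; []; [-]; _∷_)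
  import Data.List.Relation.Unary.Linked as Linked
  open import Data.Product using (_×_; _,_; proj₁; proj₂)
  open import Data.Empty using (⊥; ⊥-elim)
  open import Data.Unit using (⊤; tt)
  open import Relation.Nullary using (Dec; yes; no; ¬_)
  open import Relation.Nullary.Decidable using (_×-dec_)
  open import Relation.Binary.PropositionalEquality using (_≡_; _≢_; refl; sym; trans; cong; cong₂; subst; module ≡-Reasoning)
  open import Defs
  open FiniteSums
  open Enumerations
  open BranchingRule
  open ContentSymmetry

  Decreasing : List ℕ → Set
  Decreasing = Linked (λ a b → b ≤ a)

  decreasing-hd : ∀ {m ms} → Decreasing (m ∷ ms) → hd₀ ms ≤ m
  decreasing-hd [-]       = z≤n
  decreasing-hd (le ∷ _) = le

  decreasing-∷ : ∀ {m ms} → hd₀ ms ≤ m → Decreasing ms → Decreasing (m ∷ ms)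
  decreasing-∷ {ms = []}    _  _ = [-]
  decreasing-∷ {ms = _ ∷ _} le d = le ∷ d

  removeAt : ℕ → List ℕ → List ℕ
  removeAt _       []       = []
  removeAt zero    (x ∷ xs) = pred x ∷ xs
  removeAt (suc r) (x ∷ xs) = x ∷ removeAt r xs

  Corner : List ℕ → ℕ → Set
  Corner []       _       = ⊥
  Corner (m ∷ ms) zero    = hd₀ ms < m
  Corner (m ∷ ms) (suc r) = Corner ms r

  corner? : ∀ μ r → Dec (Corner μ r)
  corner? []       _       = no λ ()
  corner? (m ∷ ms) zero    = hd₀ ms <? m
  corner? (m ∷ ms) (suc r) = corner? ms r

  hd-removeAt : ∀ r μ → hd₀ (removeAt r μ) ≤ hd₀ μ
  hd-removeAt r       []      = z≤n
  hd-removeAt zero    (x ∷ μ) = pred[n]≤n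
  hd-removeAt (suc r) (x ∷ μ) = ≤-refl

  decreasing-removeAt : ∀ {μ} r → Decreasing μ → Corner μ r → Decreasing (removeAt r μ)
  decreasing-removeAt {suc m ∷ ms} zero    d (s≤s lt) = decreasing-∷ lt (Linked.tail d)
  decreasing-removeAt {m ∷ ms}     (suc r) d corner   =
    decreasing-∷ (≤-trans (hd-removeAt r ms) (decreasing-hd d)) (decreasing-removeAt r (Linked.tail d) corner)

  length-removeAt : ∀ r μ → length (removeAt r μ) ≡ length μ
  length-removeAt r       []      = refl
  length-removeAt zero    (x ∷ μ) = refl
  length-removeAt (suc r) (x ∷ μ) = cong suc (length-removeAt r μ)

  bounded-removeAt : ∀ {N} r {μ} → All (_≤ N) μ → All (_≤ N) (removeAt r μ)
  bounded-removeAt r       []          = []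
  bounded-removeAt zero    (x≤N ∷ μ≤N) = ≤-trans pred[n]≤n x≤N ∷ μ≤N
  bounded-removeAt (suc r) (x≤N ∷ μ≤N) = x≤N ∷ bounded-removeAt r μ≤N

  decreasing-hstrip : ∀ {μ ν} → Decreasing μ → HStrip μ ν → Decreasing ν
  decreasing-hstrip {[]}     {[]}     _ _                = []
  decreasing-hstrip {m ∷ ms} {v ∷ vs} d (_ , ms≤v , st) =
    decreasing-∷ (≤-trans (hstrip-hd st) ms≤v) (decreasing-hstrip (Linked.tail d) st)

  hstrip-refl : ∀ {μ} → Decreasing μ → HStrip μ μ
  hstrip-refl {[]}     _ = tt
  hstrip-refl {m ∷ ms} d = ≤-refl , decreasing-hd d , hstrip-refl (Linked.tail d)

  hstrip-sum : ∀ {μ ν} → HStrip μ ν → sum ν ≤ sum μ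
  hstrip-sum {[]}     {[]}     _              = z≤n
  hstrip-sum {m ∷ ms} {v ∷ vs} (v≤m , _ , st) = +-mono-≤ v≤m (hstrip-sum st)

  empty-strip : ∀ {μ ν} → Strip 0 μ ν → ν ≡ μ
  empty-strip {[]}     {[]}     _                     = refl
  empty-strip {m ∷ ms} {v ∷ vs} ((v≤m , _ , st) , size) with ≤-antisym v≤m m≤v
    where
    m≤v : m ≤ v
    m≤v = +-cancelʳ-≤ (sum ms) m v (≤-trans (≤-reflexive (trans size (+-identityʳ _))) (+-monoʳ-≤ v (hstrip-sum st)))
  ... | refl = cong (v ∷_) (empty-strip (st , +-cancelˡ-≡ v _ _ (trans size (+-assoc v (sum vs) 0))))

  AgreeUpTo : ℕ → List ℕ → List ℕ → Set
  AgreeUpTo r μ ν = take r ν ≡ take r μ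

  StripBelow : ℕ → ℕ → List ℕ → List ℕ → Set
  StripBelow r a μ ν = Strip a μ ν × AgreeUpTo r μ ν

  stripBelow? : ∀ r a μ ν → Dec (StripBelow r a μ ν)
  stripBelow? r a μ ν = strip? a μ ν ×-dec ≡-dec _≟_ (take r ν) (take r μ)

  FirstRemoval : ℕ → ℕ → List ℕ → List ℕ → ℕ → Set
  FirstRemoval r a μ ν r′ = Corner μ r′ × (r ≤ r′) × StripBelow r′ a (removeAt r′ μ) ν

  firstRemoval? : ∀ r a μ ν r′ → Dec (FirstRemoval r a μ ν r′)
  firstRemoval? r a μ ν r′ = corner? μ r′ ×-dec ((r ≤? r′) ×-dec stripBelow? r′ a (removeAt r′ μ) ν)

  module _ {m : ℕ} {ms vs : List ℕ} {r a : ℕ} where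

    private
      cancel : ∀ {b c d} → m + b ≡ (m + c) + d → b ≡ c + d
      cancel {b} {c} {d} eq = +-cancelˡ-≡ m b (c + d) (trans eq (+-assoc m c d))
      uncancel : ∀ {b c d} → b ≡ c + d → m + b ≡ (m + c) + d
      uncancel {b} {c} {d} eq = trans (cong (m +_) eq) (sym (+-assoc m c d))
      suc-≤ : ∀ {r r′} → pred r ≤ r′ → r ≤ suc r′
      suc-≤ {zero}  _     = z≤n
      suc-≤ {suc r} r≤r′ = s≤s r≤r′
      agree-tail : ∀ r → AgreeUpTo r (m ∷ ms) (m ∷ vs) → AgreeUpTo (pred r) ms vs
      agree-tail zero    _     = refl
      agree-tail (suc r) agree = proj₂ (∷-injective agree)
      agree-∷ : ∀ r → AgreeUpTo (pred r) ms vs → AgreeUpTo r (m ∷ ms) (m ∷ vs)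
      agree-∷ zero    _     = refl
      agree-∷ (suc r) agree = cong (m ∷_) agree

    firstRemoval-tail : ∀ {r′} → FirstRemoval r a (m ∷ ms) (m ∷ vs) (suc r′) → FirstRemoval (pred r) a ms vs r′
    firstRemoval-tail (corner , r≤ , ((_ , _ , st) , size) , agree) = corner , pred-mono-≤ r≤ , (st , cancel size) , proj₂ (∷-injective agree)

    firstRemoval-∷ : ∀ {r′} → Decreasing (m ∷ ms) → FirstRemoval (pred r) a ms vs r′ → FirstRemoval r a (m ∷ ms) (m ∷ vs) (suc r′)
    firstRemoval-∷ {r′} d (corner , r≤ , (st , size) , agree) =
      corner , suc-≤ r≤ , ((≤-refl , ≤-trans (hd-removeAt r′ ms) (decreasing-hd d) , st) , uncancel size) , cong (m ∷_) agree

    stripBelow-tail : StripBelow r (suc a) (m ∷ ms) (m ∷ vs) → StripBelow (pred r) (suc a) ms vs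
    stripBelow-tail (((_ , _ , st) , size) , agree) = (st , cancel size) , agree-tail r agree

    stripBelow-∷ : Decreasing (m ∷ ms) → StripBelow (pred r) (suc a) ms vs → StripBelow r (suc a) (m ∷ ms) (m ∷ vs)
    stripBelow-∷ d ((st , size) , agree) = ((≤-refl , decreasing-hd d , st) , uncancel size) , agree-∷ r agree

  ¬firstRemoval-0 : ∀ {m ms vs r a} → ¬ FirstRemoval r a (m ∷ ms) (m ∷ vs) 0
  ¬firstRemoval-0 {zero}  (() , _)
  ¬firstRemoval-0 {suc _} (_ , _ , ((m≤pred-m , _) , _) , _) = 1+n≰n m≤pred-m

  firstRemoval-0⇒stripBelow : ∀ {m v ms vs r a} → FirstRemoval r a (m ∷ ms) (v ∷ vs) 0 → StripBelow r (suc a) (m ∷ ms) (v ∷ vs)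
  firstRemoval-0⇒stripBelow {suc m′} {r = zero} {a} (_ , _ , ((v≤m′ , ms≤v , st) , size) , _) =
    ((≤-trans v≤m′ (n≤1+n m′) , ms≤v , st) , trans (cong suc size) (sym (+-suc _ a))) , refl

  stripBelow⇒firstRemoval-0 : ∀ {m v ms vs r a} → v ≢ m → StripBelow r (suc a) (m ∷ ms) (v ∷ vs) → FirstRemoval r a (m ∷ ms) (v ∷ vs) 0
  stripBelow⇒firstRemoval-0 {r = suc _} v≢m (_ , agree) = ⊥-elim (v≢m (proj₁ (∷-injective agree)))
  stripBelow⇒firstRemoval-0 {zero}  {r = zero} v≢m (((v≤0 , _) , _) , _) = ⊥-elim (v≢m (n≤0⇒n≡0 v≤0))
  stripBelow⇒firstRemoval-0 {suc m′} {r = zero} {a} v≢m (((v≤m , ms≤v , st) , size) , _) =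
    s≤s (≤-trans ms≤v v≤m′) , z≤n , ((v≤m′ , ms≤v , st) , suc-injective (trans size (+-suc _ a))) , refl
    where
    v≤m′ = ≤-pred (≤∧≢⇒< v≤m v≢m)

  ¬firstRemoval-suc : ∀ {m v ms vs r a r′} → v ≢ m → ¬ FirstRemoval r a (m ∷ ms) (v ∷ vs) (suc r′)
  ¬firstRemoval-suc v≢m (_ , _ , _ , agree) = v≢m (proj₁ (∷-injective agree))

  firstRemoval-unique : ∀ W {μ ν} r a → Decreasing μ → length μ ≤ W → length ν ≡ length μ →
                        ∑ (upTo W) (λ r′ → 𝟙 (firstRemoval? r a μ ν r′)) ≡ 𝟙 (stripBelow? r (suc a) μ ν)
  firstRemoval-unique W {[]} {[]} r a _ _ _ =
    trans (∑-0 (upTo W) _ (λ {r′} _ → 𝟙-no (firstRemoval? r a [] [] r′) proj₁))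
          (sym (𝟙-no (stripBelow? r (suc a) [] []) λ { ((_ , ()) , _) }))
  firstRemoval-unique (suc W) {m ∷ ms} {v ∷ vs} r a d (s≤s len≤W) len with v ≟ m
  ... | yes refl = begin
    ∑ (upTo (suc W)) (λ r′ → 𝟙 (firstRemoval? r a (m ∷ ms) (m ∷ vs) r′))
      ≡⟨ ∑-upTo-suc W _ ⟩
    𝟙 (firstRemoval? r a (m ∷ ms) (m ∷ vs) 0) + ∑ (upTo W) (λ r′ → 𝟙 (firstRemoval? r a (m ∷ ms) (m ∷ vs) (suc r′)))
      ≡⟨ cong₂ _+_ (𝟙-no (firstRemoval? r a (m ∷ ms) (m ∷ vs) 0) ¬firstRemoval-0)
                   (∑-cong (upTo W) (λ r′ → 𝟙-⇔ (firstRemoval? r a (m ∷ ms) (m ∷ vs) (suc r′)) (firstRemoval? (pred r) a ms vs r′)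
                                                firstRemoval-tail (firstRemoval-∷ d))) ⟩
    ∑ (upTo W) (λ r′ → 𝟙 (firstRemoval? (pred r) a ms vs r′))
      ≡⟨ firstRemoval-unique W (pred r) a (Linked.tail d) len≤W (suc-injective len) ⟩
    𝟙 (stripBelow? (pred r) (suc a) ms vs)
      ≡⟨ 𝟙-⇔ (stripBelow? (pred r) (suc a) ms vs) (stripBelow? r (suc a) (m ∷ ms) (m ∷ vs)) (stripBelow-∷ d) stripBelow-tail ⟩
    𝟙 (stripBelow? r (suc a) (m ∷ ms) (m ∷ vs))
      ∎
    where open ≡-Reasoning
  ... | no v≢m = begin
    ∑ (upTo (suc W)) (λ r′ → 𝟙 (firstRemoval? r a (m ∷ ms) (v ∷ vs) r′))
      ≡⟨ ∑-upTo-suc W _ ⟩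
    𝟙 (firstRemoval? r a (m ∷ ms) (v ∷ vs) 0) + ∑ (upTo W) (λ r′ → 𝟙 (firstRemoval? r a (m ∷ ms) (v ∷ vs) (suc r′)))
      ≡⟨ cong₂ _+_ (𝟙-⇔ (firstRemoval? r a (m ∷ ms) (v ∷ vs) 0) (stripBelow? r (suc a) (m ∷ ms) (v ∷ vs)) firstRemoval-0⇒stripBelow (stripBelow⇒firstRemoval-0 v≢m))
                   (∑-0 (upTo W) _ (λ {r′} _ → 𝟙-no (firstRemoval? r a (m ∷ ms) (v ∷ vs) (suc r′)) (¬firstRemoval-suc v≢m))) ⟩
    𝟙 (stripBelow? r (suc a) (m ∷ ms) (v ∷ vs)) + 0
      ≡⟨ +-identityʳ _ ⟩
    𝟙 (stripBelow? r (suc a) (m ∷ ms) (v ∷ vs))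
      ∎
    where open ≡-Reasoning

  stripRemovals : ℕ → List ℕ → ℕ → ℕ → (List ℕ → ℕ) → ℕ
  stripRemovals W μ r zero    g = g μ
  stripRemovals W μ r (suc a) g = ∑ (upTo W) (λ r′ → 𝟙 (corner? μ r′) * 𝟙 (r ≤? r′) * stripRemovals W (removeAt r′ μ) r′ a g)

  ∑-empty-strip : ∀ {N} μ r (g : List ℕ → ℕ) → Decreasing μ → All (_≤ N) μ →
                  ∑ (boundedLists N (length μ)) (λ ν → 𝟙 (stripBelow? r 0 μ ν) * g ν) ≡ g μ
  ∑-empty-strip {N} μ r g d μ≤N = begin
    ∑ shapes (λ ν → 𝟙 (stripBelow? r 0 μ ν) * g ν)   ≡⟨ ∑-single shapes (boundedLists-unique N (length μ)) (∈-boundedLists⁺ μ≤N refl) _ off-μ ⟩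
    𝟙 (stripBelow? r 0 μ μ) * g μ                    ≡⟨ cong (_* g μ) (𝟙-yes (stripBelow? r 0 μ μ) ((hstrip-refl d , sym (+-identityʳ _)) , refl)) ⟩
    1 * g μ                                          ≡⟨ +-identityʳ (g μ) ⟩
    g μ                                              ∎
    where
    open ≡-Reasoning
    shapes = boundedLists N (length μ)
    off-μ : ∀ {ν} → ν ∈ shapes → ν ≢ μ → 𝟙 (stripBelow? r 0 μ ν) * g ν ≡ 0
    off-μ {ν} _ ν≢μ = cong (_* g ν) (𝟙-no (stripBelow? r 0 μ ν) (λ (strip , _) → ν≢μ (empty-strip strip)))

  remove-first : ∀ {N} W μ r a (g : List ℕ → ℕ) r′ →
                 (Corner μ r′ → stripRemovals W (removeAt r′ μ) r′ a g ≡ ∑ (boundedLists N (length μ)) (λ ν → 𝟙 (stripBelow? r′ a (removeAt r′ μ) ν) * g ν)) →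
                 𝟙 (corner? μ r′) * 𝟙 (r ≤? r′) * stripRemovals W (removeAt r′ μ) r′ a g
                 ≡ ∑ (boundedLists N (length μ)) (λ ν → 𝟙 (firstRemoval? r a μ ν r′) * g ν)
  remove-first {N} W μ r a g r′ rest = begin
    𝟙 (corner? μ r′) * 𝟙 (r ≤? r′) * stripRemovals W (removeAt r′ μ) r′ a g
      ≡⟨ *-assoc (𝟙 (corner? μ r′)) _ _ ⟩
    𝟙 (corner? μ r′) * (𝟙 (r ≤? r′) * stripRemovals W (removeAt r′ μ) r′ a g)
      ≡⟨ 𝟙-*-cong (corner? μ r′) (λ corner → cong (𝟙 (r ≤? r′) *_) (rest corner)) ⟩
    𝟙 (corner? μ r′) * (𝟙 (r ≤? r′) * ∑ shapes (λ ν → 𝟙 (stripBelow? r′ a (removeAt r′ μ) ν) * g ν))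
      ≡⟨ cong (𝟙 (corner? μ r′) *_) (sym (∑-*ˡ shapes (𝟙 (r ≤? r′)) _)) ⟩
    𝟙 (corner? μ r′) * ∑ shapes (λ ν → 𝟙 (r ≤? r′) * (𝟙 (stripBelow? r′ a (removeAt r′ μ) ν) * g ν))
      ≡⟨ sym (∑-*ˡ shapes (𝟙 (corner? μ r′)) _) ⟩
    ∑ shapes (λ ν → 𝟙 (corner? μ r′) * (𝟙 (r ≤? r′) * (𝟙 (stripBelow? r′ a (removeAt r′ μ) ν) * g ν)))
      ≡⟨ ∑-cong shapes (λ ν → indicator-product (corner? μ r′) (r ≤? r′) (stripBelow? r′ a (removeAt r′ μ) ν) (g ν)) ⟩
    ∑ shapes (λ ν → 𝟙 (firstRemoval? r a μ ν r′) * g ν)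
      ∎
    where
    open ≡-Reasoning
    shapes = boundedLists N (length μ)
    indicator-product : ∀ {P Q R : Set} (p : Dec P) (q : Dec Q) (s : Dec R) x → 𝟙 p * (𝟙 q * (𝟙 s * x)) ≡ 𝟙 (p ×-dec (q ×-dec s)) * x
    indicator-product p q s x rewrite 𝟙-× p (q ×-dec s) | 𝟙-× q s = reassoc (𝟙 p) (𝟙 q) (𝟙 s) x
      where
      reassoc : ∀ a b c d → a * (b * (c * d)) ≡ a * (b * c) * d
      reassoc = solve-∀

  stripRemovals≡∑strips : ∀ W {N} μ r a (g : List ℕ → ℕ) → Decreasing μ → All (_≤ N) μ → length μ ≤ W →
                          stripRemovals W μ r a g ≡ ∑ (boundedLists N (length μ)) (λ ν → 𝟙 (stripBelow? r a μ ν) * g ν)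
  stripRemovals≡∑strips W μ r zero    g d μ≤N _     = sym (∑-empty-strip μ r g d μ≤N)
  stripRemovals≡∑strips W {N} μ r (suc a) g d μ≤N len≤W = begin
    ∑ (upTo W) (λ r′ → 𝟙 (corner? μ r′) * 𝟙 (r ≤? r′) * stripRemovals W (removeAt r′ μ) r′ a g)
      ≡⟨ ∑-cong (upTo W) (λ r′ → remove-first W μ r a g r′ (rest r′)) ⟩
    ∑ (upTo W) (λ r′ → ∑ shapes (λ ν → 𝟙 (firstRemoval? r a μ ν r′) * g ν))
      ≡⟨ ∑-comm (upTo W) shapes _ ⟩
    ∑ shapes (λ ν → ∑ (upTo W) (λ r′ → 𝟙 (firstRemoval? r a μ ν r′) * g ν))
      ≡⟨ ∑-cong-local shapes (λ {ν} ν∈ → trans (∑-*ʳ (upTo W) _ (g ν))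
                                            (cong (_* g ν) (firstRemoval-unique W r a d len≤W (proj₂ (∈-boundedLists⁻ {N} {length μ} ν∈))))) ⟩
    ∑ shapes (λ ν → 𝟙 (stripBelow? r (suc a) μ ν) * g ν)
      ∎
    where
    open ≡-Reasoning
    shapes = boundedLists N (length μ)
    rest : ∀ r′ → Corner μ r′ → stripRemovals W (removeAt r′ μ) r′ a g ≡ ∑ shapes (λ ν → 𝟙 (stripBelow? r′ a (removeAt r′ μ) ν) * g ν)
    rest r′ corner = trans
      (stripRemovals≡∑strips W (removeAt r′ μ) r′ a g (decreasing-removeAt r′ d corner) (bounded-removeAt r′ μ≤N)
         (subst (_≤ W) (sym (length-removeAt r′ μ)) len≤W))
      (cong (λ L → ∑ (boundedLists N L) (λ ν → 𝟙 (stripBelow? r′ a (removeAt r′ μ) ν) * g ν)) (length-removeAt r′ μ))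

  Allowed : Bool → ℕ → ℕ → Set
  Allowed true  _ _  = ⊤
  Allowed false r r′ = r ≤ r′

  allowed? : ∀ c r r′ → Dec (Allowed c r r′)
  allowed? true  _ _  = yes tt
  allowed? false r r′ = r ≤? r′

  isEmpty? : ∀ μ → Dec (All (_≡ 0) μ)
  isEmpty? = Data.List.Relation.Unary.All.all? (_≟ 0)

  -- Words of rows < W along which corners can be removed from μ down to the empty shape, the rows
  -- weakly increasing across every false bit; r is the row of the previous removal.
  removalCount : ℕ → List ℕ → ℕ → List Bool → ℕ
  removalCount W μ r []       = 𝟙 (isEmpty? μ)
  removalCount W μ r (c ∷ bs) = ∑ (upTo W) (λ r′ → 𝟙 (corner? μ r′) * 𝟙 (allowed? c r r′) * removalCount W (removeAt r′ μ) r′ bs)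

  removalWords : ℕ → List ℕ → List Bool → ℕ
  removalWords W μ bs = ∑ (upTo W) (λ r′ → 𝟙 (corner? μ r′) * removalCount W (removeAt r′ μ) r′ bs)

  removalCount-true : ∀ W μ r bs → removalCount W μ r (true ∷ bs) ≡ removalWords W μ bs
  removalCount-true W μ r bs = ∑-cong (upTo W) (λ r′ → cong (_* removalCount W (removeAt r′ μ) r′ bs) (*-identityʳ (𝟙 (corner? μ r′))))

  module _ (W : ℕ) (rest : List Bool) (independent : ∀ ν r → removalCount W ν r rest ≡ removalCount W ν 0 rest) where

    removalCount-false : ∀ p μ r → removalCount W μ r (replicate p false ++ rest) ≡ stripRemovals W μ r p (λ ν → removalCount W ν 0 rest)
    removalCount-false zero    μ r = independent μ r
    removalCount-false (suc p) μ r = ∑-cong (upTo W) (λ r′ →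
      cong (𝟙 (corner? μ r′) * 𝟙 (r ≤? r′) *_) (removalCount-false p (removeAt r′ μ) r′))

    removalWords-false : ∀ p μ → removalWords W μ (replicate p false ++ rest) ≡ stripRemovals W μ 0 (suc p) (λ ν → removalCount W ν 0 rest)
    removalWords-false p μ = ∑-cong (upTo W) (λ r′ →
      trans (cong (𝟙 (corner? μ r′) *_) (removalCount-false p (removeAt r′ μ) r′))
            (cong (_* stripRemovals W (removeAt r′ μ) r′ p _) (sym (*-identityʳ (𝟙 (corner? μ r′))))))

  stripRemovals-from-top : ∀ W {N} μ a (g : List ℕ → ℕ) → Decreasing μ → All (_≤ N) μ → length μ ≤ W →
                           stripRemovals W μ 0 a g ≡ ∑ (boundedLists N (length μ)) (λ ν → 𝟙 (strip? a μ ν) * g ν)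
  stripRemovals-from-top W {N} μ a g d μ≤N len≤W =
    trans (stripRemovals≡∑strips W μ 0 a g d μ≤N len≤W)
          (∑-cong (boundedLists N (length μ)) (λ ν → cong (_* g ν) (𝟙-⇔ (stripBelow? 0 a μ ν) (strip? a μ ν) proj₁ (_, refl))))

  -- The composition of k + length b built cell by cell: start with a part of size k; each bit adds
  -- one cell, which opens a new part when the bit is true.
  runs : ℕ → List Bool → List ℕ
  runs k []           = k ∷ []
  runs k (true ∷ bs)  = k ∷ runs 1 bs
  runs k (false ∷ bs) = runs (suc k) bs

  removalWords≡kostkaᴿ : ∀ W {N} p bs {μ} → Decreasing μ → All (_≤ N) μ → length μ ≤ W →
                         removalWords W μ (replicate p false ++ bs) ≡ kostkaᴿ μ (runs (suc p) bs)
  removalWords≡kostkaᴿ W {N} p [] {μ} d μ≤N len≤W = begin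
    removalWords W μ (replicate p false ++ [])
      ≡⟨ removalWords-false W [] (λ _ _ → refl) p μ ⟩
    stripRemovals W μ 0 (suc p) (λ ν → 𝟙 (isEmpty? ν))
      ≡⟨ stripRemovals-from-top W μ (suc p) _ d μ≤N len≤W ⟩
    ∑ (boundedLists N (length μ)) (λ ν → 𝟙 (strip? (suc p) μ ν) * 𝟙 (isEmpty? ν))
      ≡⟨ ∑-cong (boundedLists N (length μ)) (λ ν → cong (𝟙 (strip? (suc p) μ ν) *_) (sym (kostka-[] ν))) ⟩
    ∑ (boundedLists N (length μ)) (λ ν → 𝟙 (strip? (suc p) μ ν) * kostkaᴿ ν [])
      ≡⟨ kostkaᴿ-∷ (suc p) [] μ≤N ⟨
    kostkaᴿ μ (suc p ∷ [])
      ∎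
    where open ≡-Reasoning
  removalWords≡kostkaᴿ W {N} p (true ∷ bs) {μ} d μ≤N len≤W = begin
    removalWords W μ (replicate p false ++ true ∷ bs)
      ≡⟨ removalWords-false W (true ∷ bs) (λ _ _ → refl) p μ ⟩
    stripRemovals W μ 0 (suc p) (λ ν → removalCount W ν 0 (true ∷ bs))
      ≡⟨ stripRemovals-from-top W μ (suc p) _ d μ≤N len≤W ⟩
    ∑ shapes (λ ν → 𝟙 (strip? (suc p) μ ν) * removalCount W ν 0 (true ∷ bs))
      ≡⟨ ∑-cong-local shapes (λ ν∈ → 𝟙-*-cong (strip? (suc p) μ _) (rest ν∈)) ⟩
    ∑ shapes (λ ν → 𝟙 (strip? (suc p) μ ν) * kostkaᴿ ν (runs 1 bs))
      ≡⟨ kostkaᴿ-∷ (suc p) (runs 1 bs) μ≤N ⟨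
    kostkaᴿ μ (suc p ∷ runs 1 bs)
      ∎
    where
    open ≡-Reasoning
    shapes = boundedLists N (length μ)
    rest : ∀ {ν} → ν ∈ shapes → Strip (suc p) μ ν → removalCount W ν 0 (true ∷ bs) ≡ kostkaᴿ ν (runs 1 bs)
    rest {ν} ν∈ (hstrip , _) = let ν≤N , len = ∈-boundedLists⁻ {N} {length μ} ν∈ in
      trans (removalCount-true W ν 0 bs)
            (removalWords≡kostkaᴿ W 0 bs (decreasing-hstrip d hstrip) ν≤N (subst (_≤ W) (sym len) len≤W))
  removalWords≡kostkaᴿ W p (false ∷ bs) {μ} d μ≤N len≤W =
    trans (cong (removalWords W μ) (shift p)) (removalWords≡kostkaᴿ W (suc p) bs d μ≤N len≤W)
    where
    shift : ∀ p → replicate p false ++ false ∷ bs ≡ replicate (suc p) false ++ bs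
    shift zero    = refl
    shift (suc p) = cong (false ∷_) (shift p)

  validWord : List ℕ → List ℕ → ℕ
  validWord μ []      = 𝟙 (isEmpty? μ)
  validWord μ (r ∷ w) = 𝟙 (corner? μ r) * validWord (removeAt r μ) w

  gap : Bool → List ℕ → ℕ
  gap c (r ∷ r′ ∷ _) = 𝟙 (allowed? c r r′)
  gap c _            = 1

  respects : List Bool → List ℕ → ℕ
  respects []       _ = 1
  respects (c ∷ bs) w = gap c w * respects bs (drop 1 w)

  words : ℕ → ℕ → List (List ℕ)
  words W k = listsOfLength k (upTo W)

  ∑-words-suc : ∀ W k (f : List ℕ → ℕ) → ∑ (words W (suc k)) f ≡ ∑ (upTo W) (λ r → ∑ (words W k) (λ w → f (r ∷ w)))
  ∑-words-suc W k f = trans (∑-concatMap (λ r → map (r ∷_) (words W k)) (upTo W) f)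
                            (∑-cong (upTo W) (λ r → ∑-map (r ∷_) (words W k) f))

  removalCount-words : ∀ W μ r bs → removalCount W μ r bs ≡ ∑ (words W (length bs)) (λ w → validWord μ w * respects bs (r ∷ w))
  removalCount-words W μ r []       = sym (trans (+-identityʳ _) (*-identityʳ _))
  removalCount-words W μ r (c ∷ bs) = begin
    ∑ (upTo W) (λ r′ → 𝟙 (corner? μ r′) * 𝟙 (allowed? c r r′) * removalCount W (removeAt r′ μ) r′ bs)
      ≡⟨ ∑-cong (upTo W) (λ r′ → cong (𝟙 (corner? μ r′) * 𝟙 (allowed? c r r′) *_) (removalCount-words W (removeAt r′ μ) r′ bs)) ⟩
    ∑ (upTo W) (λ r′ → 𝟙 (corner? μ r′) * 𝟙 (allowed? c r r′) * ∑ (words W (length bs)) (λ w → validWord (removeAt r′ μ) w * respects bs (r′ ∷ w)))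
      ≡⟨ ∑-cong (upTo W) (λ r′ → trans (sym (∑-*ˡ (words W (length bs)) (𝟙 (corner? μ r′) * 𝟙 (allowed? c r r′)) _))
                                       (∑-cong (words W (length bs)) (λ w → interchange (𝟙 (corner? μ r′)) (𝟙 (allowed? c r r′)) _ _))) ⟩
    ∑ (upTo W) (λ r′ → ∑ (words W (length bs)) (λ w → validWord μ (r′ ∷ w) * respects (c ∷ bs) (r ∷ r′ ∷ w)))
      ≡⟨ ∑-words-suc W (length bs) _ ⟨
    ∑ (words W (suc (length bs))) (λ w → validWord μ w * respects (c ∷ bs) (r ∷ w))
      ∎
    where
    open ≡-Reasoning
    interchange : ∀ a b c d → a * b * (c * d) ≡ (a * c) * (b * d)
    interchange = solve-∀

  removalWords-words : ∀ W μ bs → removalWords W μ bs ≡ ∑ (words W (suc (length bs))) (λ w → validWord μ w * respects bs w)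
  removalWords-words W μ bs = begin
    ∑ (upTo W) (λ r′ → 𝟙 (corner? μ r′) * removalCount W (removeAt r′ μ) r′ bs)
      ≡⟨ ∑-cong (upTo W) (λ r′ → cong (𝟙 (corner? μ r′) *_) (removalCount-words W (removeAt r′ μ) r′ bs)) ⟩
    ∑ (upTo W) (λ r′ → 𝟙 (corner? μ r′) * ∑ (words W (length bs)) (λ w → validWord (removeAt r′ μ) w * respects bs (r′ ∷ w)))
      ≡⟨ ∑-cong (upTo W) (λ r′ → trans (sym (∑-*ˡ (words W (length bs)) (𝟙 (corner? μ r′)) _))
                                       (∑-cong (words W (length bs)) (λ w → sym (*-assoc (𝟙 (corner? μ r′)) _ _)))) ⟩
    ∑ (upTo W) (λ r′ → ∑ (words W (length bs)) (λ w → validWord μ (r′ ∷ w) * respects bs (r′ ∷ w)))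
      ≡⟨ ∑-words-suc W (length bs) _ ⟨
    ∑ (words W (suc (length bs))) (λ w → validWord μ w * respects bs w)
      ∎
    where open ≡-Reasoning

  kostkaᴿ-runs≡words : ∀ W {N} bs {μ} → Decreasing μ → All (_≤ N) μ → length μ ≤ W →
                       kostkaᴿ μ (runs 1 bs) ≡ ∑ (words W (suc (length bs))) (λ w → validWord μ w * respects bs w)
  kostkaᴿ-runs≡words W bs {μ} d μ≤N len≤W = trans (sym (removalWords≡kostkaᴿ W 0 bs d μ≤N len≤W)) (removalWords-words W μ bs)

module InclusionExclusion where

  open import Data.Nat using (ℕ; zero; suc; _+_; _*_; _∸_)
  open import Data.Nat.Properties using (+-identityʳ; *-distribˡ-+)
  open import Data.Nat.Tactic.RingSolver using (solve-∀)
  open import Data.Bool using (Bool; true; false; not)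
  open import Data.Bool.Properties using (not-involutive)
  open import Data.List using (List; []; _∷_; map; length; concatMap; foldr; drop; _++_)
  open import Data.List.Properties using (map-cong)
  open import Data.List.Membership.Propositional using (_∈_)
  open import Data.List.Membership.Propositional.Properties using (∈-++⁻; ∈-map⁻)
  open import Data.List.Relation.Unary.Any using (here)
  open import Data.Product using (_,_)
  open import Data.Sum using (_⊎_; inj₁; inj₂)
  open import Relation.Binary.PropositionalEquality using (_≡_; refl; sym; trans; cong; cong₂; module ≡-Reasoning)
  open FiniteSums
  open RemovalWords

  ∏ : {A : Set} → List A → (A → ℕ) → ℕ
  ∏ xs f = foldr _*_ 1 (map f xs)

  fromBool : Bool → ℕ
  fromBool true  = 1
  fromBool false = 0

  isEven : ℕ → Bool
  isEven zero    = true
  isEven (suc n) = not (isEven n)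

  bools : ℕ → List (List Bool)
  bools zero    = [] ∷ []
  bools (suc k) = map (true ∷_) (bools k) ++ map (false ∷_) (bools k)

  falses : List Bool → ℕ
  falses []           = 0
  falses (true ∷ bs)  = falses bs
  falses (false ∷ bs) = suc (falses bs)

  ∑-bools-suc : ∀ k (f : List Bool → ℕ) → ∑ (bools (suc k)) f ≡ ∑ (bools k) (λ b → f (true ∷ b)) + ∑ (bools k) (λ b → f (false ∷ b))
  ∑-bools-suc k f = trans (∑-++ (map (true ∷_) (bools k)) _ f) (cong₂ _+_ (∑-map (true ∷_) (bools k) f) (∑-map (false ∷_) (bools k) f))

  length-bools : ∀ k {b} → b ∈ bools k → length b ≡ k
  length-bools zero    (here refl) = refl
  length-bools (suc k) {b} b∈ with ∈-++⁻ (map (true ∷_) (bools k)) b∈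
  ... | inj₁ b∈ᵗ = let b′ , b′∈ , eq = ∈-map⁻ (true ∷_) b∈ᵗ in trans (cong length eq) (cong suc (length-bools k b′∈))
  ... | inj₂ b∈ᶠ = let b′ , b′∈ , eq = ∈-map⁻ (false ∷_) b∈ᶠ in trans (cong length eq) (cong suc (length-bools k b′∈))

  module _ {J B : Set} where

    tuples : List J → List B → List (List B)
    tuples []       X = [] ∷ []
    tuples (j ∷ js) X = concatMap (λ x → map (x ∷_) (tuples js X)) X

    ∏pairwise : (J → B → ℕ) → List J → List B → ℕ
    ∏pairwise f (j ∷ js) (x ∷ xs) = f j x * ∏pairwise f js xs
    ∏pairwise f _        _        = 1

    ∏-∑ : (f : J → B → ℕ) (js : List J) (X : List B) → ∏ js (λ j → ∑ X (f j)) ≡ ∑ (tuples js X) (∏pairwise f js)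
    ∏-∑ f []       X = refl
    ∏-∑ f (j ∷ js) X = begin
      ∑ X (f j) * ∏ js (λ j → ∑ X (f j))                           ≡⟨ cong (∑ X (f j) *_) (∏-∑ f js X) ⟩
      ∑ X (f j) * ∑ (tuples js X) (∏pairwise f js)                 ≡⟨ ∑-*ʳ X (f j) _ ⟨
      ∑ X (λ x → f j x * ∑ (tuples js X) (∏pairwise f js))         ≡⟨ ∑-cong X (λ x → sym (∑-*ˡ (tuples js X) (f j x) _)) ⟩
      ∑ X (λ x → ∑ (tuples js X) (λ xs → ∏pairwise f (j ∷ js) (x ∷ xs)))  ≡⟨ ∑-cong X (λ x → ∑-map (x ∷_) (tuples js X) _) ⟨
      ∑ X (λ x → ∑ (map (x ∷_) (tuples js X)) (∏pairwise f (j ∷ js)))     ≡⟨ ∑-concatMap (λ x → map (x ∷_) (tuples js X)) X _ ⟨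
      ∑ (tuples (j ∷ js) X) (∏pairwise f (j ∷ js))                 ∎
      where open ≡-Reasoning

    ∏pairwise-* : (f g : J → B → ℕ) (js : List J) (xs : List B) →
                  ∏pairwise (λ j x → f j x * g j x) js xs ≡ ∏pairwise f js xs * ∏pairwise g js xs
    ∏pairwise-* f g []       xs       = refl
    ∏pairwise-* f g (j ∷ js) []       = refl
    ∏pairwise-* f g (j ∷ js) (x ∷ xs) = trans (cong (f j x * g j x *_) (∏pairwise-* f g js xs))
                                              (interchange (f j x) (g j x) _ _)
      where
      interchange : ∀ a b c d → a * b * (c * d) ≡ a * c * (b * d)
      interchange = solve-∀

    ∏pairwise-map : (f : J → B → ℕ) (g : B → B) (js : List J) (xs : List B) →
                    ∏pairwise f js (map g xs) ≡ ∏pairwise (λ j x → f j (g x)) js xs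
    ∏pairwise-map f g []       xs       = refl
    ∏pairwise-map f g (j ∷ js) []       = refl
    ∏pairwise-map f g (j ∷ js) (x ∷ xs) = cong (f j (g x) *_) (∏pairwise-map f g js xs)

    ∏pairwise-1 : (f : J → B → ℕ) → (∀ j x → f j x ≡ 1) → ∀ js xs → ∏pairwise f js xs ≡ 1
    ∏pairwise-1 f f≡1 []       xs       = refl
    ∏pairwise-1 f f≡1 (j ∷ js) []       = refl
    ∏pairwise-1 f f≡1 (j ∷ js) (x ∷ xs) rewrite f≡1 j x = trans (+-identityʳ _) (∏pairwise-1 f f≡1 js xs)

    ∏pairwise-01 : (f : J → B → ℕ) → (∀ j x → f j x ≡ 0 ⊎ f j x ≡ 1) → ∀ js xs → ∏pairwise f js xs ≡ 0 ⊎ ∏pairwise f js xs ≡ 1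
    ∏pairwise-01 f f01 []       xs       = inj₂ refl
    ∏pairwise-01 f f01 (j ∷ js) []       = inj₂ refl
    ∏pairwise-01 f f01 (j ∷ js) (x ∷ xs) with f01 j x | ∏pairwise-01 f f01 js xs
    ... | inj₁ fx≡0 | _          rewrite fx≡0           = inj₁ refl
    ... | inj₂ fx≡1 | inj₁ rest≡0 rewrite fx≡1 | rest≡0 = inj₁ refl
    ... | inj₂ fx≡1 | inj₂ rest≡1 rewrite fx≡1 | rest≡1 = inj₂ refl

  module SignedCount {J : Set} (js : List J) where

    tails : List (List ℕ) → List (List ℕ)
    tails = map (drop 1)

    respectsAll : List Bool → List (List ℕ) → ℕ
    respectsAll b ws = ∏pairwise (λ _ w → respects b w) js ws

    gapAll : Bool → List (List ℕ) → ℕ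
    gapAll c ws = ∏pairwise (λ _ w → gap c w) js ws

    respectsAll-∷ : ∀ c b ws → respectsAll (c ∷ b) ws ≡ gapAll c ws * respectsAll b (tails ws)
    respectsAll-∷ c b ws = trans (∏pairwise-* (λ _ w → gap c w) (λ _ w → respects b (drop 1 w)) js ws)
                                 (cong (gapAll c ws *_) (sym (∏pairwise-map (λ _ w → respects b w) (drop 1) js ws)))

    respectsAll-[] : ∀ ws → respectsAll [] ws ≡ 1
    respectsAll-[] = ∏pairwise-1 _ (λ _ _ → refl) js

    gapAll-true : ∀ ws → gapAll true ws ≡ 1
    gapAll-true = ∏pairwise-1 _ (λ _ w → gap-true w) js
      where
      gap-true : ∀ w → gap true w ≡ 1
      gap-true []           = refl
      gap-true (_ ∷ [])     = refl
      gap-true (_ ∷ _ ∷ _) = refl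

    gapAll-false : ∀ ws → gapAll false ws ≡ 0 ⊎ gapAll false ws ≡ 1
    gapAll-false = ∏pairwise-01 _ (λ _ w → gap-false w) js
      where
      gap-false : ∀ w → gap false w ≡ 0 ⊎ gap false w ≡ 1
      gap-false []            = inj₂ refl
      gap-false (_ ∷ [])      = inj₂ refl
      gap-false (r ∷ r′ ∷ _) = 𝟙≡0⊎𝟙≡1 (allowed? false r r′)

    weighted : (Bool → Bool) → ℕ → List (List ℕ) → ℕ
    weighted σ k ws = ∑ (bools k) (λ b → fromBool (σ (isEven (falses b))) * respectsAll b ws)

    weighted-suc : ∀ σ k ws → weighted σ (suc k) ws ≡ weighted σ k (tails ws) + gapAll false ws * weighted (λ e → σ (not e)) k (tails ws)
    weighted-suc σ k ws = trans (∑-bools-suc k _) (cong₂ _+_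
      (∑-cong (bools k) (λ b → cong (fromBool (σ (isEven (falses b))) *_)
        (trans (respectsAll-∷ true b ws) (trans (cong (_* respectsAll b (tails ws)) (gapAll-true ws)) (+-identityʳ _)))))
      (trans (∑-cong (bools k) (λ b → trans (cong (fromBool (σ (not (isEven (falses b)))) *_) (respectsAll-∷ false b ws))
                                             (swap (fromBool (σ (not (isEven (falses b))))) (gapAll false ws) _)))
             (∑-*ˡ (bools k) (gapAll false ws) _)))
      where
      swap : ∀ a b c → a * (b * c) ≡ b * (a * c)
      swap = solve-∀

    noCommonAscent : ℕ → List (List ℕ) → ℕ
    noCommonAscent zero    ws = 1
    noCommonAscent (suc k) ws = (1 ∸ gapAll false ws) * noCommonAscent k (tails ws)

    weighted-not-not : ∀ k ws → weighted (λ e → not (not e)) k ws ≡ weighted (λ e → e) k ws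
    weighted-not-not k ws = ∑-cong (bools k) (λ b → cong (λ e → fromBool e * respectsAll b ws) (not-involutive (isEven (falses b))))

    -- The signed sum over b of (-1)^(falses b) · respectsAll b ws factors over the gaps as ∏ (1 - gapAll false);
    -- it is split into its even and odd parts to stay in ℕ.
    even≡odd+noCommonAscent : ∀ k ws → weighted (λ e → e) k ws ≡ weighted not k ws + noCommonAscent k ws
    even≡odd+noCommonAscent zero    ws = cong (_+ 0) (trans (+-identityʳ _) (respectsAll-[] ws))
    even≡odd+noCommonAscent (suc k) ws = begin
      weighted (λ e → e) (suc k) ws                      ≡⟨ weighted-suc (λ e → e) k ws ⟩
      weighted (λ e → e) k ws′ + A * O                   ≡⟨ cong (_+ A * O) (even≡odd+noCommonAscent k ws′) ⟩
      (O + E) + A * O                                    ≡⟨ exchange (gapAll-false ws) ⟩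
      (O + A * (O + E)) + (1 ∸ A) * E                    ≡⟨ cong (λ x → (O + A * x) + (1 ∸ A) * E)
                                                              (trans (sym (even≡odd+noCommonAscent k ws′)) (sym (weighted-not-not k ws′))) ⟩
      (O + A * weighted (λ e → not (not e)) k ws′) + (1 ∸ A) * E ≡⟨ cong (_+ (1 ∸ A) * E) (weighted-suc not k ws) ⟨
      weighted not (suc k) ws + noCommonAscent (suc k) ws ∎
      where
      open ≡-Reasoning
      ws′ = tails ws
      A = gapAll false ws
      O = weighted not k ws′
      E = noCommonAscent k ws′
      exchange : A ≡ 0 ⊎ A ≡ 1 → (O + E) + A * O ≡ (O + A * (O + E)) + (1 ∸ A) * E
      exchange (inj₁ A≡0) rewrite A≡0 = close₀ O E
        where
        close₀ : ∀ O E → O + E + 0 * O ≡ O + 0 * (O + E) + 1 * E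
        close₀ = solve-∀
      exchange (inj₂ A≡1) rewrite A≡1 = close₁ O E
        where
        close₁ : ∀ O E → O + E + 1 * O ≡ O + 1 * (O + E) + 0 * E
        close₁ = solve-∀

    module _ (k : ℕ) (X : List (List ℕ)) (val : J → List ℕ → ℕ) (Z : J → List Bool → ℕ)
             (Z≡ : ∀ {b} → b ∈ bools k → ∀ j → Z j b ≡ ∑ X (λ w → val j w * respects b w)) where

      private
        V : List (List ℕ) → ℕ
        V ws = ∏pairwise val js ws

      ∑-weighted-∏ : ∀ σ → ∑ (bools k) (λ b → fromBool (σ (isEven (falses b))) * ∏ js (λ j → Z j b))
                           ≡ ∑ (tuples js X) (λ ws → V ws * weighted σ k ws)
      ∑-weighted-∏ σ = begin
        ∑ (bools k) (λ b → s b * ∏ js (λ j → Z j b))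
          ≡⟨ ∑-cong-local (bools k) (λ {b} b∈ → cong (s b *_) (expand b∈)) ⟩
        ∑ (bools k) (λ b → s b * ∑ (tuples js X) (λ ws → V ws * respectsAll b ws))
          ≡⟨ ∑-cong (bools k) (λ b → sym (∑-*ˡ (tuples js X) (s b) _)) ⟩
        ∑ (bools k) (λ b → ∑ (tuples js X) (λ ws → s b * (V ws * respectsAll b ws)))
          ≡⟨ ∑-comm (bools k) (tuples js X) _ ⟩
        ∑ (tuples js X) (λ ws → ∑ (bools k) (λ b → s b * (V ws * respectsAll b ws)))
          ≡⟨ ∑-cong (tuples js X) (λ ws → trans (∑-cong (bools k) (λ b → swap (s b) (V ws) _)) (∑-*ˡ (bools k) (V ws) _)) ⟩
        ∑ (tuples js X) (λ ws → V ws * weighted σ k ws)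
          ∎
        where
        open ≡-Reasoning
        s : List Bool → ℕ
        s b = fromBool (σ (isEven (falses b)))
        swap : ∀ a b c → a * (b * c) ≡ b * (a * c)
        swap = solve-∀
        expand : ∀ {b} → b ∈ bools k → ∏ js (λ j → Z j b) ≡ ∑ (tuples js X) (λ ws → V ws * respectsAll b ws)
        expand {b} b∈ = trans (cong (foldr _*_ 1) (map-cong (Z≡ b∈) js))
          (trans (∏-∑ (λ j w → val j w * respects b w) js X)
                 (∑-cong (tuples js X) (∏pairwise-* val (λ _ w → respects b w) js)))

      inclusion-exclusion : ∑ (bools k) (λ b → fromBool (isEven (falses b)) * ∏ js (λ j → Z j b))
                            ≡ ∑ (bools k) (λ b → fromBool (not (isEven (falses b))) * ∏ js (λ j → Z j b))
                              + ∑ (tuples js X) (λ ws → V ws * noCommonAscent k ws)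
      inclusion-exclusion = begin
        ∑ (bools k) (λ b → fromBool (isEven (falses b)) * ∏ js (λ j → Z j b))
          ≡⟨ ∑-weighted-∏ (λ e → e) ⟩
        ∑ (tuples js X) (λ ws → V ws * weighted (λ e → e) k ws)
          ≡⟨ ∑-cong (tuples js X) (λ ws → trans (cong (V ws *_) (even≡odd+noCommonAscent k ws)) (*-distribˡ-+ (V ws) _ _)) ⟩
        ∑ (tuples js X) (λ ws → V ws * weighted not k ws + V ws * noCommonAscent k ws)
          ≡⟨ ∑-+ (tuples js X) _ _ ⟩
        ∑ (tuples js X) (λ ws → V ws * weighted not k ws) + ∑ (tuples js X) (λ ws → V ws * noCommonAscent k ws)
          ≡⟨ cong (_+ ∑ (tuples js X) (λ ws → V ws * noCommonAscent k ws)) (∑-weighted-∏ not) ⟨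
        ∑ (bools k) (λ b → fromBool (not (isEven (falses b))) * ∏ js (λ j → Z j b)) + ∑ (tuples js X) (λ ws → V ws * noCommonAscent k ws)
          ∎
        where open ≡-Reasoning

module Compositions where

  open import Data.Nat using (ℕ; zero; suc; pred; _+_; _*_; _∸_; _≤_; _<_; _≤?_; _≟_; z≤n; s≤s; _!)
  open import Data.Nat.Properties using (+-comm; ≤-refl; ≤-reflexive; ≤-trans; +-suc; +-identityʳ; *-assoc; suc-injective; n≤0⇒n≡0; ≮⇒≥; ≤∧≢⇒<; 1+n≰n; m≤n⇒m≤1+n; +-∸-assoc; n∸n≡0; +-cancelˡ-≡; ≤-decTotalOrder)
  open import Data.Nat.Tactic.RingSolver using (solve-∀)
  open import Data.Nat.ListAction using (sum)
  open import Data.Bool using (Bool; true; false)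
  open import Data.List using (List; []; _∷_; map; length; replicate; _++_; filter; upTo; applyUpTo; concatMap)
  open import Data.List.Properties using (≡-dec; ++-identityʳ; length-++; length-replicate; length-map; ∷-injective; map-cong; map-∘)
  open import Data.List.Membership.Propositional using (_∈_; find; lose)
  open import Data.List.Membership.Propositional.Properties using (∈-++⁺ˡ; ∈-++⁺ʳ; ∈-map⁺; ∈-map⁻; ∈-filter⁺; ∈-filter⁻; ∈-upTo⁺; ∈-upTo⁻; ∈-concatMap⁺; ∈-concatMap⁻; ∈-∃++)
  open import Data.List.Relation.Unary.Any using (here; there)
  open import Data.List.Relation.Unary.All using (All; []; _∷_)
  import Data.List.Relation.Unary.All as All
  import Data.List.Relation.Unary.All.Properties as All
  open import Data.List.Relation.Unary.Unique.Propositional using (Unique; []; _∷_)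
  import Data.List.Relation.Unary.Unique.Propositional.Properties as Unique
  open import Data.List.Relation.Binary.Permutation.Propositional using (_↭_; ↭⇒↭ₛ; ↭-refl; ↭-reflexive; ↭-sym; ↭-trans; prep)
  open import Data.List.Relation.Binary.Permutation.Propositional.Properties using (↭-length; All-resp-↭) renaming (shift to ↭-shift)
  open import Data.Nat.ListAction.Properties using (sum-↭)
  open import Data.Unit using (⊤; tt)
  open import Data.List.Relation.Binary.Pointwise using (Pointwise-≡⇒≡)
  open import Data.List.Relation.Unary.Sorted.TotalOrder.Properties using (↗↭↗⇒≋)
  open import Data.Product using (_×_; _,_; proj₁; proj₂)
  open import Data.Empty using (⊥-elim)
  open import Relation.Nullary using (¬_; Dec; yes; no)
  open import Relation.Binary.Bundles using (DecTotalOrder)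
  open import Relation.Binary.Construct.Flip.EqAndOrd using (decTotalOrder)
  open import Relation.Binary.PropositionalEquality using (_≡_; _≢_; refl; sym; trans; cong; cong₂; subst; subst₂; module ≡-Reasoning)
  open import Defs using (prodFact; oneTo; IsPartition; partitionsOf)
  open Enumerations using (InRange; part≤sum; partitionsOf-unique; ∈-partitionsOf⁺; ∈-partitionsOf⁻)
  open FiniteSums
  open Tableaux using (occ)
  open RemovalWords
  open InclusionExclusion

  ≥-decTotalOrder : DecTotalOrder _ _ _
  ≥-decTotalOrder = decTotalOrder ≤-decTotalOrder

  open import Data.List.Sort ≥-decTotalOrder public using (sort; sort-↭; sort-↗)

  sorted-unique : ∀ {xs ys} → Decreasing xs → Decreasing ys → xs ↭ ys → xs ≡ ys
  sorted-unique xs↘ ys↘ xs↭ys = Pointwise-≡⇒≡ (↗↭↗⇒≋ (DecTotalOrder.totalOrder ≥-decTotalOrder) xs↘ ys↘ (↭⇒↭ₛ xs↭ys))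

  trues : List Bool → ℕ
  trues []           = 0
  trues (true ∷ bs)  = suc (trues bs)
  trues (false ∷ bs) = trues bs

  trues+falses : ∀ bs → trues bs + falses bs ≡ length bs
  trues+falses []           = refl
  trues+falses (true ∷ bs)  = cong suc (trues+falses bs)
  trues+falses (false ∷ bs) = trans (+-suc (trues bs) (falses bs)) (cong suc (trues+falses bs))

  bools-∈⁺ : ∀ b → b ∈ bools (length b)
  bools-∈⁺ []          = here refl
  bools-∈⁺ (true ∷ b)  = ∈-++⁺ˡ (∈-map⁺ (true ∷_) (bools-∈⁺ b))
  bools-∈⁺ (false ∷ b) = ∈-++⁺ʳ (map (true ∷_) (bools (length b))) (∈-map⁺ (false ∷_) (bools-∈⁺ b))

  bools-unique : ∀ k → Unique (bools k)
  bools-unique zero    = [] ∷ []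
  bools-unique (suc k) = Unique.++⁺ (Unique.map⁺ tail-injective (bools-unique k)) (Unique.map⁺ tail-injective (bools-unique k)) apart
    where
    tail-injective : ∀ {c b b′} → _≡_ {A = List Bool} (c ∷ b) (c ∷ b′) → b ≡ b′
    tail-injective eq = proj₂ (∷-injective eq)
    apart : ∀ {b} → ¬ (b ∈ map (true ∷_) (bools k) × b ∈ map (false ∷_) (bools k))
    apart (b∈ᵗ , b∈ᶠ) with ∈-map⁻ (true ∷_) b∈ᵗ | ∈-map⁻ (false ∷_) b∈ᶠ
    ... | _ , _ , refl | _ , _ , ()

  runs-sum : ∀ k b → sum (runs k b) ≡ k + length b
  runs-sum k []           = refl
  runs-sum k (true ∷ b)   = cong (k +_) (runs-sum 1 b)
  runs-sum k (false ∷ b)  = trans (runs-sum (suc k) b) (sym (+-suc k (length b)))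

  runs-positive : ∀ {k} b → 1 ≤ k → All (1 ≤_) (runs k b)
  runs-positive []          1≤k = 1≤k ∷ []
  runs-positive (true ∷ b)  1≤k = 1≤k ∷ runs-positive b ≤-refl
  runs-positive (false ∷ b) _   = runs-positive b (s≤s z≤n)

  runs-length : ∀ k b → length (runs k b) ≡ suc (trues b)
  runs-length k []          = refl
  runs-length k (true ∷ b)  = cong suc (runs-length 1 b)
  runs-length k (false ∷ b) = runs-length (suc k) b

  runs-replicate : ∀ k p b → runs k (replicate p false ++ b) ≡ runs (k + p) b
  runs-replicate k zero    b = cong (λ k → runs k b) (sym (+-identityʳ k))
  runs-replicate k (suc p) b = trans (runs-replicate (suc k) p b) (cong (λ k → runs k b) (sym (+-suc k p)))

  cuts : List ℕ → List Bool
  cuts []            = []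
  cuts (a ∷ [])      = replicate (pred a) false
  cuts (a ∷ b ∷ α)   = replicate (pred a) false ++ true ∷ cuts (b ∷ α)

  cuts-∷ : ∀ a {α} → α ≢ [] → cuts (a ∷ α) ≡ replicate (pred a) false ++ true ∷ cuts α
  cuts-∷ a {[]}    α≢[] = ⊥-elim (α≢[] refl)
  cuts-∷ a {_ ∷ _} _    = refl

  runs≢[] : ∀ k b → runs k b ≢ []
  runs≢[] k []          ()
  runs≢[] k (true ∷ b)  ()
  runs≢[] k (false ∷ b) = runs≢[] (suc k) b

  cuts-runs : ∀ k b → cuts (runs (suc k) b) ≡ replicate k false ++ b
  cuts-runs k []          = sym (++-identityʳ (replicate k false))
  cuts-runs k (true ∷ b)  = trans (cuts-∷ (suc k) (runs≢[] 1 b)) (cong (λ b → replicate k false ++ true ∷ b) (cuts-runs 0 b))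
  cuts-runs k (false ∷ b) = trans (cuts-runs (suc k) b) (shift k)
    where
    shift : ∀ k → replicate (suc k) false ++ b ≡ replicate k false ++ false ∷ b
    shift zero    = refl
    shift (suc k) = cong (false ∷_) (shift k)

  runs-cuts : ∀ {α} → All (1 ≤_) α → α ≢ [] → runs 1 (cuts α) ≡ α
  runs-cuts {[]}              _           α≢[] = ⊥-elim (α≢[] refl)
  runs-cuts {zero ∷ _}        (() ∷ _)    _
  runs-cuts {suc p ∷ []}      _           _    = trans (cong (runs 1) (sym (++-identityʳ (replicate p false)))) (runs-replicate 1 p [])
  runs-cuts {suc p ∷ b ∷ α}   (_ ∷ α≥1)  _    =
    trans (runs-replicate 1 p (true ∷ cuts (b ∷ α))) (cong (suc p ∷_) (runs-cuts α≥1 λ ()))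

  cuts-length : ∀ {α} → All (1 ≤_) α → α ≢ [] → suc (length (cuts α)) ≡ sum α
  cuts-length {[]}             _          α≢[] = ⊥-elim (α≢[] refl)
  cuts-length {zero ∷ _}       (() ∷ _)  _
  cuts-length {suc p ∷ []}     _          _    = cong suc (trans (length-replicate p) (sym (+-identityʳ p)))
  cuts-length {suc p ∷ b ∷ α} (_ ∷ α≥1) _    =
    cong suc (trans (length-++ (replicate p false)) (cong₂ _+_ (length-replicate p) (cuts-length α≥1 λ ())))

  at : List ℕ → ℕ → ℕ
  at []       _       = 0
  at (x ∷ _)  zero    = x
  at (_ ∷ xs) (suc i) = at xs i

  incrementAt : ℕ → List ℕ → List ℕ
  incrementAt _       []       = []
  incrementAt zero    (x ∷ xs) = suc x ∷ xs
  incrementAt (suc i) (x ∷ xs) = x ∷ incrementAt i xs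

  incrementAt-removeAt : ∀ {i m} → 1 ≤ at m i → incrementAt i (removeAt i m) ≡ m
  incrementAt-removeAt {zero}  {suc x ∷ m} _   = refl
  incrementAt-removeAt {suc i} {x ∷ m}     1≤ = cong (x ∷_) (incrementAt-removeAt {i} {m} 1≤)

  removeAt-incrementAt : ∀ i m → removeAt i (incrementAt i m) ≡ m
  removeAt-incrementAt i       []      = refl
  removeAt-incrementAt zero    (x ∷ m) = refl
  removeAt-incrementAt (suc i) (x ∷ m) = cong (x ∷_) (removeAt-incrementAt i m)


  at-incrementAt : ∀ {i m} → i < length m → at (incrementAt i m) i ≡ suc (at m i)
  at-incrementAt {zero}  {x ∷ m} _          = refl
  at-incrementAt {suc i} {x ∷ m} (s≤s i<m) = at-incrementAt {i} {m} i<m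

  sum-incrementAt : ∀ {i m} → i < length m → sum (incrementAt i m) ≡ suc (sum m)
  sum-incrementAt {zero}  {x ∷ m} _          = refl
  sum-incrementAt {suc i} {x ∷ m} (s≤s i<m) = trans (cong (x +_) (sum-incrementAt {i} {m} i<m)) (+-suc x (sum m))

  sum-removeAt : ∀ {i m} → 1 ≤ at m i → sum m ≡ suc (sum (removeAt i m))
  sum-removeAt {zero}  {suc x ∷ m} _   = refl
  sum-removeAt {suc i} {x ∷ m}     1≤ = trans (cong (x +_) (sum-removeAt {i} {m} 1≤)) (+-suc x _)

  prodFact-removeAt : ∀ {i m} → 1 ≤ at m i → prodFact m ≡ at m i * prodFact (removeAt i m)
  prodFact-removeAt {zero}  {suc x ∷ m} _   = *-assoc (suc x) (x !) (prodFact m)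
  prodFact-removeAt {suc i} {x ∷ m}     1≤ = trans (cong ((x !) *_) (prodFact-removeAt {i} {m} 1≤)) (*-comm-middle (x !) (at m i) _)
    where
    *-comm-middle : ∀ a b c → a * (b * c) ≡ b * (a * c)
    *-comm-middle = solve-∀

  positions : List ℕ → List ℕ
  positions m = filter (λ i → 1 ≤? at m i) (upTo (length m))

  arrangements : ℕ → List ℕ → List (List ℕ)
  arrangements zero    m = [] ∷ []
  arrangements (suc s) m = concatMap (λ i → map (suc i ∷_) (arrangements s (removeAt i m))) (positions m)

  ∈-positions⁻ : ∀ {i m} → i ∈ positions m → (i < length m) × (1 ≤ at m i)
  ∈-positions⁻ {i} {m} i∈ = let i∈upTo , 1≤ = ∈-filter⁻ (λ i → 1 ≤? at m i) {xs = upTo (length m)} i∈ in ∈-upTo⁻ i∈upTo , 1≤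

  ∈-positions⁺ : ∀ {i m} → i < length m → 1 ≤ at m i → i ∈ positions m
  ∈-positions⁺ {i} {m} i<m 1≤ = ∈-filter⁺ (λ i → 1 ≤? at m i) (∈-upTo⁺ i<m) 1≤

  ∑-positions : ∀ m → ∑ (positions m) (at m) ≡ sum m
  ∑-positions m = trans (∑-filter-0 (λ i → 1 ≤? at m i) (upTo (length m)) (at m) (λ {i} ¬1≤ → n≤0⇒n≡0 (≮⇒≥ ¬1≤)))
                        (∑-at m)
    where
    ∑-at : ∀ m → ∑ (upTo (length m)) (at m) ≡ sum m
    ∑-at []      = refl
    ∑-at (x ∷ m) = trans (∑-upTo-suc (length m) (at (x ∷ m))) (cong (x +_) (∑-at m))

  multinomial : ∀ s m → sum m ≡ s → prodFact m * length (arrangements s m) ≡ s !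
  multinomial zero    m sum≡0 = trans (cong (_* 1) (prodFact-zero m sum≡0)) refl
    where
    prodFact-zero : ∀ m → sum m ≡ 0 → prodFact m ≡ 1
    prodFact-zero []       _     = refl
    prodFact-zero (zero ∷ m) sum≡0 = trans (+-identityʳ _) (prodFact-zero m sum≡0)
  multinomial (suc s) m sum≡ = begin
    prodFact m * length (arrangements (suc s) m)
      ≡⟨ cong (prodFact m *_) (trans (length-concatMap _ (positions m)) (∑-cong (positions m) (λ i → length-map (suc i ∷_) (arrangements s (removeAt i m))))) ⟩
    prodFact m * ∑ (positions m) (λ i → length (arrangements s (removeAt i m)))
      ≡⟨ ∑-*ˡ (positions m) (prodFact m) _ ⟨
    ∑ (positions m) (λ i → prodFact m * length (arrangements s (removeAt i m)))
      ≡⟨ ∑-cong-local (positions m) first-letter ⟩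
    ∑ (positions m) (λ i → at m i * s !)
      ≡⟨ ∑-*ʳ (positions m) (at m) (s !) ⟩
    ∑ (positions m) (at m) * s !
      ≡⟨ cong (_* s !) (trans (∑-positions m) sum≡) ⟩
    suc s !
      ∎
    where
    open ≡-Reasoning
    first-letter : ∀ {i} → i ∈ positions m → prodFact m * length (arrangements s (removeAt i m)) ≡ at m i * s !
    first-letter {i} i∈ = let _ , 1≤ = ∈-positions⁻ {i} {m} i∈ in
      trans (cong (_* length (arrangements s (removeAt i m))) (prodFact-removeAt {i} {m} 1≤))
            (trans (*-assoc (at m i) _ _)
                   (cong (at m i *_) (multinomial s (removeAt i m) (suc-injective (trans (sym (sum-removeAt {i} {m} 1≤)) sum≡)))))

  counts : ℕ → ℕ → List ℕ → List ℕ
  counts o zero    α = []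
  counts o (suc L) α = occ (suc o) α ∷ counts (suc o) L α

  length-counts : ∀ o L α → length (counts o L α) ≡ L
  length-counts o zero    α = refl
  length-counts o (suc L) α = cong suc (length-counts (suc o) L α)

  occ-∷-≢ : ∀ {i x} α → x ≢ i → occ i (x ∷ α) ≡ occ i α
  occ-∷-≢ {i} {x} α x≢i = cong (_+ occ i α) (𝟙-no (x ≟ i) x≢i)

  occ-∷-≡ : ∀ x α → occ x (x ∷ α) ≡ suc (occ x α)
  occ-∷-≡ x α = cong (_+ occ x α) (𝟙-yes (x ≟ x) refl)

  counts-skip : ∀ {x o} L α → x ≤ o → counts o L (x ∷ α) ≡ counts o L α
  counts-skip zero    α x≤o = refl
  counts-skip (suc L) α x≤o = cong₂ _∷_ (occ-∷-≢ α (λ { refl → 1+n≰n x≤o })) (counts-skip L α (m≤n⇒m≤1+n x≤o))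

  counts-∷ : ∀ {x o} L α → o < x → x ≤ o + L → counts o L (x ∷ α) ≡ incrementAt (x ∸ suc o) (counts o L α)
  counts-∷ {x} {o} zero    α o<x x≤o+0 = ⊥-elim (1+n≰n (≤-trans o<x (≤-trans x≤o+0 (≤-reflexive (+-identityʳ o)))))
  counts-∷ {x} {o} (suc L) α o<x x≤o+L with x ≟ suc o
  ... | yes refl = trans (cong (suc (occ (suc o) α) ∷_) (counts-skip L α ≤-refl))
                          (cong (λ i → incrementAt i (counts o (suc L) α)) (sym (n∸n≡0 o)))
  ... | no x≢1+o = begin
    occ (suc o) α ∷ counts (suc o) L (x ∷ α)
      ≡⟨ cong (occ (suc o) α ∷_) (counts-∷ L α 1+o<x (subst (x ≤_) (+-suc o L) x≤o+L)) ⟩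
    occ (suc o) α ∷ incrementAt (x ∸ suc (suc o)) (counts (suc o) L α)
      ≡⟨ cong (λ i → incrementAt i (counts o (suc L) α)) (+-∸-assoc 1 1+o<x) ⟨
    incrementAt (x ∸ suc o) (counts o (suc L) α)
      ∎
    where
    open ≡-Reasoning
    1+o<x : suc o < x
    1+o<x = ≤∧≢⇒< o<x (λ eq → x≢1+o (sym eq))

  counts-nil : ∀ o L → counts o L [] ≡ replicate L 0
  counts-nil o zero    = refl
  counts-nil o (suc L) = cong (0 ∷_) (counts-nil (suc o) L)

  counts-↭ : ∀ o L {xs ys} → xs ↭ ys → counts o L xs ≡ counts o L ys
  counts-↭ o zero    p = refl
  counts-↭ o (suc L) p = cong₂ _∷_ (∑-↭ _ p) (counts-↭ (suc o) L p)

  counts⇒occ : ∀ o L {xs ys} → counts o L xs ≡ counts o L ys → ∀ {i} → o < i → i ≤ o + L → occ i xs ≡ occ i ys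
  counts⇒occ o zero    _  {i} o<i i≤o+0 = ⊥-elim (1+n≰n (≤-trans o<i (≤-trans i≤o+0 (≤-reflexive (+-identityʳ o)))))
  counts⇒occ o (suc L) eq {i} o<i i≤o+L with i ≟ suc o
  ... | yes refl = proj₁ (∷-injective eq)
  ... | no i≢1+o = counts⇒occ (suc o) L (proj₂ (∷-injective eq)) (≤∧≢⇒< o<i (λ eq → i≢1+o (sym eq))) (subst (i ≤_) (+-suc o L) i≤o+L)

  x∸1<L : ∀ {x L} → 1 ≤ x → x ≤ L → x ∸ 1 < L
  x∸1<L {suc x} _ x<L = x<L

  sum-counts : ∀ L {α} → InRange L α → sum (counts 0 L α) ≡ length α
  sum-counts L {[]}    []                    = trans (cong sum (counts-nil 0 L)) (sum-replicate-0 L)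
    where
    sum-replicate-0 : ∀ L → sum (replicate L 0) ≡ 0
    sum-replicate-0 zero    = refl
    sum-replicate-0 (suc L) = sum-replicate-0 L
  sum-counts L {x ∷ α} ((1≤x , x≤L) ∷ α∈) = begin
    sum (counts 0 L (x ∷ α))                ≡⟨ cong sum (counts-∷ L α 1≤x x≤L) ⟩
    sum (incrementAt (x ∸ 1) (counts 0 L α)) ≡⟨ sum-incrementAt {x ∸ 1} {counts 0 L α} (subst (x ∸ 1 <_) (sym (length-counts 0 L α)) (x∸1<L 1≤x x≤L)) ⟩
    suc (sum (counts 0 L α))                 ≡⟨ cong suc (sum-counts L α∈) ⟩
    suc (length α)                           ∎
    where open ≡-Reasoning

  ∈-arrangements⁻ : ∀ s m {α} → sum m ≡ s → α ∈ arrangements s m → InRange (length m) α × (counts 0 (length m) α ≡ m)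
  ∈-arrangements⁻ zero    m {[]} sum≡0 (here refl) = [] , trans (counts-nil 0 (length m)) (sym (all-zero m sum≡0))
    where
    all-zero : ∀ m → sum m ≡ 0 → m ≡ replicate (length m) 0
    all-zero []         _     = refl
    all-zero (zero ∷ m) sum≡0 = cong (0 ∷_) (all-zero m sum≡0)
  ∈-arrangements⁻ (suc s) m {α} sum≡ α∈ with find (∈-concatMap⁻ (λ i → map (suc i ∷_) (arrangements s (removeAt i m))) {xs = positions m} α∈)
  ... | i , i∈ , α∈′ with ∈-map⁻ (suc i ∷_) α∈′
  ... | α′ , α′∈ , refl =
    let i<m , 1≤ = ∈-positions⁻ {i} {m} i∈
        range , counts≡ = ∈-arrangements⁻ s (removeAt i m) (suc-injective (trans (sym (sum-removeAt {i} {m} 1≤)) sum≡)) α′∈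
        L≡ = length-removeAt i m
    in (s≤s z≤n , i<m) ∷ subst (λ L → InRange L α′) L≡ range ,
       (begin
         counts 0 (length m) (suc i ∷ α′)           ≡⟨ counts-∷ (length m) α′ (s≤s z≤n) i<m ⟩
         incrementAt i (counts 0 (length m) α′)     ≡⟨ cong (λ L → incrementAt i (counts 0 L α′)) L≡ ⟨
         incrementAt i (counts 0 (length (removeAt i m)) α′) ≡⟨ cong (incrementAt i) counts≡ ⟩
         incrementAt i (removeAt i m)               ≡⟨ incrementAt-removeAt {i} {m} 1≤ ⟩
         m                                          ∎)
    where open ≡-Reasoning

  ∈-arrangements⁺ : ∀ L {α} → InRange L α → α ∈ arrangements (length α) (counts 0 L α)
  ∈-arrangements⁺ L {[]}          []                      = here refl
  ∈-arrangements⁺ L {suc x ∷ α}   ((_ , x<L) ∷ α∈) =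
    ∈-concatMap⁺ (λ i → map (suc i ∷_) (arrangements (length α) (removeAt i m))) {xs = positions m}
      (lose (∈-positions⁺ {x} {m} x<m 1≤) (∈-map⁺ (suc x ∷_) (subst (λ m′ → α ∈ arrangements (length α) m′) (sym removed) (∈-arrangements⁺ L α∈))))
    where
    m = counts 0 L (suc x ∷ α)
    m≡ : m ≡ incrementAt x (counts 0 L α)
    m≡ = counts-∷ L α (s≤s z≤n) x<L
    x<m : x < length m
    x<m = subst (x <_) (sym (length-counts 0 L (suc x ∷ α))) x<L
    1≤ : 1 ≤ at m x
    1≤ = subst (λ m′ → 1 ≤ at m′ x) (sym m≡)
           (subst (1 ≤_) (sym (at-incrementAt {x} {counts 0 L α} (subst (x <_) (sym (length-counts 0 L α)) x<L))) (s≤s z≤n))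
    removed : removeAt x m ≡ counts 0 L α
    removed = trans (cong (removeAt x) m≡) (removeAt-incrementAt x (counts 0 L α))

  arrangements-unique : ∀ s m → Unique (arrangements s m)
  arrangements-unique zero    m = [] ∷ []
  arrangements-unique (suc s) m =
    unique-concatMap⁺ (λ i → map (suc i ∷_) (arrangements s (removeAt i m)))
      (Unique.filter⁺ (λ i → 1 ≤? at m i) (Unique.upTo⁺ (length m)))
      (λ i → Unique.map⁺ (λ eq → proj₂ (∷-injective eq)) (arrangements-unique s (removeAt i m)))
      (λ _ _ → same-first)
    where
    same-first : ∀ {i i′ α} → α ∈ map (suc i ∷_) (arrangements s (removeAt i m)) → α ∈ map (suc i′ ∷_) (arrangements s (removeAt i′ m)) → i ≡ i′
    same-first α∈ α∈′ with ∈-map⁻ _ α∈ | ∈-map⁻ _ α∈′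
    ... | _ , _ , refl | _ , _ , eq = suc-injective (proj₁ (∷-injective eq))

  occ-positive⇒∈ : ∀ x ys → 1 ≤ occ x ys → x ∈ ys
  occ-positive⇒∈ x (y ∷ ys) 1≤ with y ≟ x
  ... | yes refl = here refl
  ... | no _     = there (occ-positive⇒∈ x ys 1≤)

  occ⇒↭ : ∀ L {xs ys} → InRange L xs → InRange L ys → (∀ {i} → 1 ≤ i → i ≤ L → occ i xs ≡ occ i ys) → xs ↭ ys
  occ⇒↭ L {[]}     {[]}     _ _ _ = ↭-refl
  occ⇒↭ L {[]}     {y ∷ ys} _ ((1≤y , y≤L) ∷ _) same with trans (same 1≤y y≤L) (occ-∷-≡ y ys)
  ... | ()
  occ⇒↭ L {x ∷ xs} {ys} ((1≤x , x≤L) ∷ xs∈) ys∈ same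
    with ∈-∃++ (occ-positive⇒∈ x ys (subst (1 ≤_) (trans (sym (occ-∷-≡ x xs)) (same 1≤x x≤L)) (s≤s z≤n)))
  ... | ys₁ , ys₂ , refl =
    ↭-trans (prep x (occ⇒↭ L xs∈ (drop-middle ys∈) same′)) (↭-sym (↭-shift x ys₁ ys₂))
    where
    drop-middle : InRange L (ys₁ ++ x ∷ ys₂) → InRange L (ys₁ ++ ys₂)
    drop-middle range = let r₁ , r₂ = All.++⁻ ys₁ range in All.++⁺ r₁ (All.tail r₂)
    same′ : ∀ {i} → 1 ≤ i → i ≤ L → occ i xs ≡ occ i (ys₁ ++ ys₂)
    same′ {i} 1≤i i≤L = +-cancelˡ-≡ (𝟙 (x ≟ i)) _ _ (begin
      𝟙 (x ≟ i) + occ i xs                        ≡⟨ same 1≤i i≤L ⟩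
      occ i (ys₁ ++ x ∷ ys₂)                      ≡⟨ ∑-++ ys₁ (x ∷ ys₂) _ ⟩
      occ i ys₁ + (𝟙 (x ≟ i) + occ i ys₂)         ≡⟨ +-comm-left (occ i ys₁) (𝟙 (x ≟ i)) (occ i ys₂) ⟩
      𝟙 (x ≟ i) + (occ i ys₁ + occ i ys₂)         ≡⟨ cong (𝟙 (x ≟ i) +_) (∑-++ ys₁ ys₂ _) ⟨
      𝟙 (x ≟ i) + occ i (ys₁ ++ ys₂)              ∎)
      where
      open ≡-Reasoning
      +-comm-left : ∀ a b c → a + (b + c) ≡ b + (a + c)
      +-comm-left = solve-∀

  oneTo-suc : ∀ L → oneTo (suc L) ≡ 1 ∷ map suc (oneTo L)
  oneTo-suc L = cong (λ xs → 1 ∷ map suc xs) (applyUpTo-map suc (λ i → i) L)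
    where
    applyUpTo-map : ∀ (g f : ℕ → ℕ) L → applyUpTo (λ i → g (f i)) L ≡ map g (applyUpTo f L)
    applyUpTo-map g f zero    = refl
    applyUpTo-map g f (suc L) = cong (g (f 0) ∷_) (applyUpTo-map g (λ i → f (suc i)) L)

  counts-oneTo : ∀ o L α → counts o L α ≡ map (λ i → occ (o + i) α) (oneTo L)
  counts-oneTo o zero    α = refl
  counts-oneTo o (suc L) α = begin
    occ (suc o) α ∷ counts (suc o) L α                                 ≡⟨ cong₂ _∷_ (cong (λ i → occ i α) (sym (+-comm o 1))) (counts-oneTo (suc o) L α) ⟩
    occ (o + 1) α ∷ map (λ i → occ (suc o + i) α) (oneTo L)           ≡⟨ cong (occ (o + 1) α ∷_) (trans (map-cong (λ i → cong (λ j → occ j α) (sym (+-suc o i))) (oneTo L)) (map-∘ (oneTo L))) ⟩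
    occ (o + 1) α ∷ map (λ i → occ (o + i) α) (map suc (oneTo L))     ≡⟨ cong (map (λ i → occ (o + i) α)) (oneTo-suc L) ⟨
    map (λ i → occ (o + i) α) (oneTo (suc L))                          ∎
    where open ≡-Reasoning

  partition-range : ∀ {n λ′} → IsPartition n λ′ → InRange n λ′
  partition-range {λ′ = λ′} (refl , pos , _) = All.zipWith (λ (1≤x , x≤n) → 1≤x , x≤n) (pos , part≤sum λ′)

  module Regroup (n′ : ℕ) where

    private
      n = suc n′

    arrangementCount : List ℕ → ℕ
    arrangementCount λ′ = length (arrangements (length λ′) (counts 0 n λ′))

    sortsTo? : ∀ b λ′ → Dec (sort (runs 1 b) ≡ λ′)
    sortsTo? b λ′ = ≡-dec _≟_ (sort (runs 1 b)) λ′

    Composition : List ℕ → Set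
    Composition α = (sum α ≡ n) × All (1 ≤_) α

    runs-composition : ∀ {b} → b ∈ bools n′ → Composition (runs 1 b)
    runs-composition {b} b∈ = trans (runs-sum 1 b) (cong suc (length-bools n′ b∈)) , runs-positive b ≤-refl

    composition-range : ∀ {α} → Composition α → InRange n α
    composition-range {α} (sum≡n , pos) = All.zipWith (λ (1≤x , x≤sum) → 1≤x , subst (_ ≤_) sum≡n x≤sum) (pos , part≤sum α)

    sort-partition : ∀ {α} → Composition α → IsPartition n (sort α)
    sort-partition {α} (sum≡n , pos) = trans (sum-↭ (sort-↭ α)) sum≡n , All-resp-↭ (↭-sym (sort-↭ α)) pos , sort-↗ α

    fiber : ∀ {λ′} → λ′ ∈ partitionsOf n → ∑ (bools n′) (λ b → 𝟙 (sortsTo? b λ′)) ≡ arrangementCount λ′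
    fiber {λ′} λ′∈ = trans (∑𝟙-bijection (bools-unique n′) (arrangements-unique (length λ′) m) (λ b → sortsTo? b λ′) (λ _ → yes tt) (runs 1) cuts forward backward)
                           (sym (length≡∑1 (arrangements (length λ′) m)))
      where
      m = counts 0 n λ′
      isPartition = ∈-partitionsOf⁻ λ′∈
      λ′-range = partition-range isPartition
      forward : ∀ {b} → b ∈ bools n′ → sort (runs 1 b) ≡ λ′ → (runs 1 b ∈ arrangements (length λ′) m) × ⊤ × (cuts (runs 1 b) ≡ b)
      forward {b} b∈ sorted≡λ′ =
        subst₂ (λ L m′ → runs 1 b ∈ arrangements L m′) (↭-length runs↭λ′) (counts-↭ 0 n runs↭λ′)
          (∈-arrangements⁺ n (composition-range (runs-composition b∈))) ,
        tt , cuts-runs 0 b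
        where
        runs↭λ′ : runs 1 b ↭ λ′
        runs↭λ′ = ↭-trans (↭-sym (sort-↭ (runs 1 b))) (↭-reflexive sorted≡λ′)
      backward : ∀ {α} → α ∈ arrangements (length λ′) m → ⊤ → (cuts α ∈ bools n′) × (sort (runs 1 (cuts α)) ≡ λ′) × (runs 1 (cuts α) ≡ α)
      backward {α} α∈ _ = subst (λ L → cuts α ∈ bools L) length-cuts (bools-∈⁺ (cuts α)) , trans (cong sort runs-cuts-α) sort-α , runs-cuts-α
        where
        arranged = ∈-arrangements⁻ (length λ′) m (sum-counts n λ′-range) α∈
        α-range : InRange n α
        α-range = subst (λ L → InRange L α) (length-counts 0 n λ′) (proj₁ arranged)
        α↭λ′ : α ↭ λ′
        α↭λ′ = occ⇒↭ n α-range λ′-range (counts⇒occ 0 n (subst (λ L → counts 0 L α ≡ m) (length-counts 0 n λ′) (proj₂ arranged)))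
        pos : All (1 ≤_) α
        pos = All.map proj₁ α-range
        sum-α : sum α ≡ n
        sum-α = trans (sum-↭ α↭λ′) (proj₁ isPartition)
        α≢[] : α ≢ []
        α≢[] refl with sum-α
        ... | ()
        runs-cuts-α = runs-cuts pos α≢[]
        length-cuts : length (cuts α) ≡ n′
        length-cuts = suc-injective (trans (cuts-length pos α≢[]) sum-α)
        sort-α : sort α ≡ λ′
        sort-α = sorted-unique (sort-↗ α) (proj₂ (proj₂ isPartition)) (↭-trans (sort-↭ α) α↭λ′)

    regroup : (F : List ℕ → ℕ) → (∀ α → F (sort α) ≡ F α) →
              ∑ (bools n′) (λ b → F (runs 1 b)) ≡ ∑ (partitionsOf n) (λ λ′ → arrangementCount λ′ * F λ′)
    regroup F F-sort = begin
      ∑ (bools n′) (λ b → F (runs 1 b))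
        ≡⟨ ∑-cong-local (bools n′) (λ b∈ → sym (single b∈)) ⟩
      ∑ (bools n′) (λ b → ∑ P (λ λ′ → 𝟙 (sortsTo? b λ′) * F (runs 1 b)))
        ≡⟨ ∑-comm (bools n′) P _ ⟩
      ∑ P (λ λ′ → ∑ (bools n′) (λ b → 𝟙 (sortsTo? b λ′) * F (runs 1 b)))
        ≡⟨ ∑-cong P (λ λ′ → ∑-cong (bools n′) (λ b → 𝟙-*-cong (sortsTo? b λ′) (λ sorted≡λ′ → trans (sym (F-sort (runs 1 b))) (cong F sorted≡λ′)))) ⟩
      ∑ P (λ λ′ → ∑ (bools n′) (λ b → 𝟙 (sortsTo? b λ′) * F λ′))
        ≡⟨ ∑-cong-local P (λ {λ′} λ′∈ → trans (∑-*ʳ (bools n′) _ (F λ′)) (cong (_* F λ′) (fiber λ′∈))) ⟩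
      ∑ P (λ λ′ → arrangementCount λ′ * F λ′)
        ∎
      where
      open ≡-Reasoning
      P = partitionsOf n
      single : ∀ {b} → b ∈ bools n′ → ∑ P (λ λ′ → 𝟙 (sortsTo? b λ′) * F (runs 1 b)) ≡ F (runs 1 b)
      single {b} b∈ = trans (∑-single P (partitionsOf-unique n) (∈-partitionsOf⁺ (sort-partition (runs-composition b∈))) _
                               (λ {λ′} _ λ′≢ → cong (_* F (runs 1 b)) (𝟙-no (sortsTo? b λ′) (λ eq → λ′≢ (sym eq)))))
                            (trans (cong (_* F (runs 1 b)) (𝟙-yes (sortsTo? b (sort (runs 1 b))) refl)) (+-identityʳ _))

module IntegerSums where

  open import Data.Nat using (ℕ; zero; suc; NonZero)
  import Data.Nat as ℕ
  open import Data.Nat.Properties using (+-identityʳ)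
  open import Data.Bool using (Bool; not)
  open import Data.Bool.Properties using (not-involutive)
  open import Data.Integer as ℤ using (ℤ; +_; _+_; _-_; _*_; -_; _^_; 1ℤ)
  import Data.Integer.Properties as ℤ
  import Data.Integer.Tactic.RingSolver as ℤ-Solver
  open import Data.Rational as ℚ using (ℚ; _/_)
  import Data.Rational.Properties as ℚ
  import Data.Rational.Unnormalised as ℚᵘ
  import Data.Rational.Unnormalised.Properties as ℚᵘ
  open import Data.List using (List; []; _∷_; map; foldr)
  open import Relation.Binary.PropositionalEquality using (_≡_; refl; sym; trans; cong; cong₂; module ≡-Reasoning)
  open FiniteSums using (∑)
  open InclusionExclusion using (fromBool; isEven)

  ∑ℤ : {A : Set} → List A → (A → ℤ) → ℤ
  ∑ℤ xs f = foldr _+_ (+ 0) (map f xs)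

  /-cross : ∀ (a b : ℤ) d e .{{_ : NonZero d}} .{{_ : NonZero e}} → a * + e ≡ b * + d → a / d ≡ b / e
  /-cross a b (suc d) (suc e) eq = ℚ.fromℚᵘ-cong {ℚᵘ.mkℚᵘ a d} {ℚᵘ.mkℚᵘ b e} (ℚᵘ.*≡* eq)

  ∑ℚ-integers : {A : Set} (xs : List A) (f : A → ℤ) → foldr ℚ._+_ ℚ.0ℚ (map (λ x → f x / 1) xs) ≡ ∑ℤ xs f / 1
  ∑ℚ-integers xs f = ℚ.toℚᵘ-injective (ℚᵘ.≃-trans (unnormalised xs) (ℚᵘ.≃-sym (integer (∑ℤ xs f))))
    where
    integer : ∀ z → ℚ.toℚᵘ (z / 1) ℚᵘ.≃ ℚᵘ.mkℚᵘ z 0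
    integer z = ℚ.toℚᵘ-fromℚᵘ (ℚᵘ.mkℚᵘ z 0)
    add : ∀ a b → ℚᵘ.mkℚᵘ a 0 ℚᵘ.+ ℚᵘ.mkℚᵘ b 0 ℚᵘ.≃ ℚᵘ.mkℚᵘ (a + b) 0
    add a b = ℚᵘ.*≡* (cross a b)
      where
      cross : ∀ a b → (a * + 1 + b * + 1) * + 1 ≡ (a + b) * + 1
      cross = ℤ-Solver.solve-∀
    unnormalised : (xs : List _) → ℚ.toℚᵘ (foldr ℚ._+_ ℚ.0ℚ (map (λ x → f x / 1) xs)) ℚᵘ.≃ ℚᵘ.mkℚᵘ (∑ℤ xs f) 0
    unnormalised []       = ℚᵘ.≃-refl
    unnormalised (x ∷ xs) = ℚᵘ.≃-trans (ℚ.toℚᵘ-homo-+ (f x / 1) _)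
                              (ℚᵘ.≃-trans (ℚᵘ.+-cong (integer (f x)) (unnormalised xs)) (add (f x) (∑ℤ xs f)))

  sign-split : ∀ k N → (- 1ℤ) ^ k * + N ≡ + (fromBool (isEven k) ℕ.* N) - + (fromBool (not (isEven k)) ℕ.* N)
  sign-split zero    N = trans (ℤ.*-identityˡ (+ N)) (trans (cong +_ (sym (+-identityʳ N))) (sym (ℤ.+-identityʳ (+ (N ℕ.+ 0)))))
  sign-split (suc k) N = begin
    (- 1ℤ) ^ suc k * + N                  ≡⟨ ℤ.*-assoc (- 1ℤ) ((- 1ℤ) ^ k) (+ N) ⟩
    - 1ℤ * ((- 1ℤ) ^ k * + N)             ≡⟨ cong (- 1ℤ *_) (sign-split k N) ⟩
    - 1ℤ * (+ (weight e) - + (weight (not e))) ≡⟨ negate (+ weight e) (+ weight (not e)) ⟩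
    + (weight (not e)) - + (weight e)      ≡⟨ cong (λ e′ → + weight (not e) - + weight e′) (not-involutive e) ⟨
    + (weight (not e)) - + (weight (not (not e))) ∎
    where
    open ≡-Reasoning
    e = isEven k
    weight : Bool → ℕ
    weight b = fromBool b ℕ.* N
    negate : ∀ a b → - 1ℤ * (a - b) ≡ b - a
    negate = ℤ-Solver.solve-∀

  ∑ℤ-difference : {A : Set} (xs : List A) (f g : A → ℕ) → ∑ℤ xs (λ x → + f x - + g x) ≡ + ∑ xs f - + ∑ xs g
  ∑ℤ-difference []       f g = refl
  ∑ℤ-difference (x ∷ xs) f g = begin
    (+ f x - + g x) + ∑ℤ xs (λ x → + f x - + g x)   ≡⟨ cong (λ s → (+ f x - + g x) + s) (∑ℤ-difference xs f g) ⟩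
    (+ f x - + g x) + (+ ∑ xs f - + ∑ xs g)         ≡⟨ regroup (+ f x) (+ g x) (+ ∑ xs f) (+ ∑ xs g) ⟩
    (+ f x + + ∑ xs f) - (+ g x + + ∑ xs g)         ≡⟨ cong₂ _-_ (ℤ.pos-+ (f x) (∑ xs f)) (ℤ.pos-+ (g x) (∑ xs g)) ⟨
    + ∑ (x ∷ xs) f - + ∑ (x ∷ xs) g                 ∎
    where
    open ≡-Reasoning
    regroup : ∀ a b c d → (a - b) + (c - d) ≡ (a + c) - (b + d)
    regroup = ℤ-Solver.solve-∀

open import Data.Nat using (ℕ; zero; suc; _+_; _*_; _∸_; _≤_; _!)
open import Data.Nat.Properties using (m+n∸m≡n)
open import Data.Nat.Tactic.RingSolver using (solve-∀)
open import Data.Bool using (Bool; not)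
open import Data.Fin using (Fin)
open import Data.Integer as ℤ using (ℤ; +_; -_; 1ℤ)
import Data.Integer.Properties as ℤ
import Data.Integer.Tactic.RingSolver as ℤ-Solver
open import Data.Rational as ℚ using (ℚ; _/_)
open import Data.List using (List; map; length; foldr; allFin)
open import Data.List.Properties using (map-cong; map-cong-local)
open import Data.List.Membership.Propositional using (_∈_)
open import Data.List.Relation.Unary.All using (All)
import Data.List.Relation.Unary.All as All
open import Data.List.Relation.Binary.Permutation.Propositional using (_↭_; ↭-sym)
open import Data.List.Relation.Binary.Permutation.Propositional.Properties using (↭-length; ↭-reverse)
open import Data.Product using (∃-syntax; _,_; proj₁; proj₂)
open import Relation.Binary.PropositionalEquality using (_≡_; sym; trans; cong; cong₂; subst; module ≡-Reasoning)
open import Defs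
open FiniteSums
open Enumerations
open Tableaux using (count≡occ)
open ContentSymmetry
open RemovalWords
open InclusionExclusion
open Compositions
open IntegerSums

kostkaProd-↭ : ∀ {t N} (μ : Fin t → List ℕ) → (∀ j → All (_≤ N) (μ j)) → ∀ {α β} → α ↭ β → kostkaProd t μ α ≡ kostkaProd t μ β
kostkaProd-↭ {t} μ μ≤N α↭β = cong (foldr _*_ 1) (map-cong (λ j → kostka-↭ (μ≤N j) α↭β) (allFin t))

module _ (n′ : ℕ) where
  open Regroup n′

  private
    n = suc n′

  multFactProd-arrangements : ∀ {λ′} → λ′ ∈ partitionsOf n → multFactProd n λ′ * arrangementCount λ′ ≡ ℓ λ′ !
  multFactProd-arrangements {λ′} λ′∈ = trans (cong (λ m → prodFact m * arrangementCount λ′) multiplicities)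
    (multinomial (length λ′) (counts 0 n λ′) (sum-counts n (partition-range (∈-partitionsOf⁻ λ′∈))))
    where
    multiplicities : map (λ i → mult i λ′) (oneTo n) ≡ counts 0 n λ′
    multiplicities = trans (map-cong (λ i → count≡occ i λ′) (oneTo n)) (sym (counts-oneTo 0 n λ′))

  falses≡ : ∀ {b} → b ∈ bools n′ → n ∸ length (runs 1 b) ≡ falses b
  falses≡ {b} b∈ = trans (cong₂ _∸_ (cong suc (trans (sym (length-bools n′ b∈)) (sym (trues+falses b)))) (runs-length 1 b))
                         (m+n∸m≡n (trues b) (falses b))

  module _ (t : ℕ) (μ : Fin t → List ℕ) (μ-partition : ∀ j → IsPartition n (μ j)) where

    private
      K : List ℕ → ℕ
      K = kostkaProd t μ
      P = partitionsOf n
      μ≤n : ∀ j → All (_≤ n) (μ j)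
      μ≤n j = subst (λ s → All (_≤ s) (μ j)) (proj₁ (μ-partition j)) (part≤sum (μ j))

    signedTerm : List ℕ → ℤ
    signedTerm λ′ = (- 1ℤ) ℤ.^ (n ∸ ℓ λ′) ℤ.* + (arrangementCount λ′ * K λ′)

    term-integral : ∀ {λ′} → λ′ ∈ P → term n t μ λ′ ≡ signedTerm λ′ / 1
    term-integral {λ′} λ′∈ =
      /-cross (s ℤ.* + (ℓ λ′ !) ℤ.* + K λ′) (signedTerm λ′) mfp 1 {{prodFact≢0 (map (λ i → mult i λ′) (oneTo n))}} cross
      where
      open ≡-Reasoning
      s = (- 1ℤ) ℤ.^ (n ∸ ℓ λ′)
      mfp = multFactProd n λ′
      arr = arrangementCount λ′
      rearrange : ∀ s a c k → s ℤ.* (a ℤ.* c) ℤ.* k ℤ.* + 1 ≡ s ℤ.* (c ℤ.* k) ℤ.* a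
      rearrange = ℤ-Solver.solve-∀
      cross : s ℤ.* + (ℓ λ′ !) ℤ.* + K λ′ ℤ.* + 1 ≡ signedTerm λ′ ℤ.* + mfp
      cross = begin
        s ℤ.* + (ℓ λ′ !) ℤ.* + K λ′ ℤ.* + 1          ≡⟨ cong (λ f → s ℤ.* + f ℤ.* + K λ′ ℤ.* + 1) (multFactProd-arrangements λ′∈) ⟨
        s ℤ.* + (mfp * arr) ℤ.* + K λ′ ℤ.* + 1        ≡⟨ cong (λ f → s ℤ.* f ℤ.* + K λ′ ℤ.* + 1) (ℤ.pos-* mfp arr) ⟩
        s ℤ.* (+ mfp ℤ.* + arr) ℤ.* + K λ′ ℤ.* + 1    ≡⟨ rearrange s (+ mfp) (+ arr) (+ K λ′) ⟩
        s ℤ.* (+ arr ℤ.* + K λ′) ℤ.* + mfp            ≡⟨ cong (λ f → s ℤ.* f ℤ.* + mfp) (ℤ.pos-* arr (K λ′)) ⟨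
        signedTerm λ′ ℤ.* + mfp                       ∎

    parityWeighted : (Bool → Bool) → ℕ
    parityWeighted σ = ∑ P (λ λ′ → fromBool (σ (isEven (n ∸ ℓ λ′))) * (arrangementCount λ′ * K λ′))

    theSum-signed : theSum n t μ ≡ (+ parityWeighted (λ e → e) ℤ.- + parityWeighted not) / 1
    theSum-signed = begin
      theSum n t μ                                   ≡⟨ cong (foldr ℚ._+_ ℚ.0ℚ) (map-cong-local (All.tabulate term-integral)) ⟩
      foldr ℚ._+_ ℚ.0ℚ (map (λ λ′ → signedTerm λ′ / 1) P) ≡⟨ ∑ℚ-integers P signedTerm ⟩
      ∑ℤ P signedTerm / 1                            ≡⟨ cong (_/ 1) (trans (cong (foldr ℤ._+_ (+ 0)) (map-cong (λ λ′ → sign-split (n ∸ ℓ λ′) _) P))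
                                                                          (∑ℤ-difference P _ _)) ⟩
      (+ parityWeighted (λ e → e) ℤ.- + parityWeighted not) / 1 ∎
      where open ≡-Reasoning

    private
      js = allFin t
      allWords = words n (suc n′)

      kostkaOfRuns : Fin t → List Bool → ℕ
      kostkaOfRuns j b = kostka (μ j) (runs 1 b)

      kostkaOfRuns≡words : ∀ {b} → b ∈ bools n′ → ∀ j → kostkaOfRuns j b ≡ ∑ allWords (λ w → validWord (μ j) w * respects b w)
      kostkaOfRuns≡words {b} b∈ j = begin
        kostka (μ j) (runs 1 b)                                            ≡⟨ kostka-↭ (μ≤n j) (↭-sym (↭-reverse (runs 1 b))) ⟩
        kostkaᴿ (μ j) (runs 1 b)                                           ≡⟨ kostkaᴿ-runs≡words n b (proj₂ (proj₂ (μ-partition j))) (μ≤n j) length≤n ⟩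
        ∑ (words n (suc (length b))) (λ w → validWord (μ j) w * respects b w) ≡⟨ cong (λ k → ∑ (words n (suc k)) (λ w → validWord (μ j) w * respects b w)) (length-bools n′ b∈) ⟩
        ∑ allWords (λ w → validWord (μ j) w * respects b w)                       ∎
        where
        open ≡-Reasoning
        length≤n : length (μ j) ≤ n
        length≤n = subst (length (μ j) ≤_) (proj₁ (μ-partition j)) (length≤sum (proj₁ (proj₂ (μ-partition j))))

    parityWeighted-bits : ∀ σ → parityWeighted σ ≡ ∑ (bools n′) (λ b → fromBool (σ (isEven (falses b))) * ∏ js (λ j → kostkaOfRuns j b))
    parityWeighted-bits σ = begin
      parityWeighted σ                                               ≡⟨ ∑-cong P (λ λ′ → swap (fromBool (σ (isEven (n ∸ ℓ λ′)))) (arrangementCount λ′) (K λ′)) ⟩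
      ∑ P (λ λ′ → arrangementCount λ′ * F λ′)                        ≡⟨ regroup F F-sort ⟨
      ∑ (bools n′) (λ b → F (runs 1 b))                              ≡⟨ ∑-cong-local (bools n′) (λ {b} b∈ → cong (λ k → fromBool (σ (isEven k)) * K (runs 1 b)) (falses≡ b∈)) ⟩
      ∑ (bools n′) (λ b → fromBool (σ (isEven (falses b))) * ∏ js (λ j → kostkaOfRuns j b)) ∎
      where
      open ≡-Reasoning
      F : List ℕ → ℕ
      F λ′ = fromBool (σ (isEven (n ∸ ℓ λ′))) * K λ′
      F-sort : ∀ α → F (sort α) ≡ F α
      F-sort α = cong₂ (λ l k → fromBool (σ (isEven (n ∸ l))) * k) (↭-length (sort-↭ α)) (kostkaProd-↭ μ μ≤n (sort-↭ α))
      swap : ∀ a b c → a * (b * c) ≡ b * (a * c)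
      swap = solve-∀

    open SignedCount js using (noCommonAscent)

    tuplesWithoutCommonAscent : ℕ
    tuplesWithoutCommonAscent = ∑ (tuples js allWords) (λ ws → ∏pairwise (λ j → validWord (μ j)) js ws * noCommonAscent n′ ws)

    even≡odd+tuplesWithoutCommonAscent : parityWeighted (λ e → e) ≡ parityWeighted not + tuplesWithoutCommonAscent
    even≡odd+tuplesWithoutCommonAscent = begin
      parityWeighted (λ e → e)                                        ≡⟨ parityWeighted-bits (λ e → e) ⟩
      ∑ (bools n′) (λ b → fromBool (isEven (falses b)) * ∏ js (λ j → kostkaOfRuns j b))  ≡⟨ SignedCount.inclusion-exclusion js n′ allWords (λ j → validWord (μ j)) kostkaOfRuns kostkaOfRuns≡words ⟩
      ∑ (bools n′) (λ b → fromBool (not (isEven (falses b))) * ∏ js (λ j → kostkaOfRuns j b)) + tuplesWithoutCommonAscent ≡⟨ cong (_+ tuplesWithoutCommonAscent) (parityWeighted-bits not) ⟨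
      parityWeighted not + tuplesWithoutCommonAscent                        ∎
      where open ≡-Reasoning

corollary4p13 : (t n : ℕ) → 1 ≤ t → 1 ≤ n →
    (μ : Fin t → List ℕ) → ((j : Fin t) → IsPartition n (μ j)) →
    ∃[ m ] (theSum n t μ ≡ (+ m) / 1)
corollary4p13 t zero    _ () μ μ-partition
corollary4p13 t (suc n′) _ _  μ μ-partition = M , (begin
  theSum (suc n′) t μ                         ≡⟨ theSum-signed n′ t μ μ-partition ⟩
  (+ even ℤ.- + odd) / 1                      ≡⟨ cong (λ e → (+ e ℤ.- + odd) / 1) (even≡odd+tuplesWithoutCommonAscent n′ t μ μ-partition) ⟩
  (+ (odd + M) ℤ.- + odd) / 1                 ≡⟨ cong (_/ 1) (trans (cong (ℤ._- + odd) (ℤ.pos-+ odd M)) (cancel (+ odd) (+ M))) ⟩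
  (+ M) / 1                                   ∎)
  where
  open ≡-Reasoning
  M = tuplesWithoutCommonAscent n′ t μ μ-partition
  even = parityWeighted n′ t μ μ-partition (λ e → e)
  odd = parityWeighted n′ t μ μ-partition not
  cancel : ∀ a b → a ℤ.+ b ℤ.- a ≡ b
  cancel = ℤ-Solver.solve-∀
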